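{- Let $G$ be a wheel with at least three spokes and let $G'$ be obtained from $G$ by performing a vertex-to-edge bridging on $\{x,ab\}$. Then $G'$ is super-minimally $3$-connected if and only if $x$ is the hub of $G$ and $ab$ is a rim edge. In particular, if $G'$ is super-minimally $3$-connected, then $G'$ is a wheel.
   Context: All graphs are finite and simple. A wheel with $n$ spokes is obtained from an $n$-vertex cycle (the rim) by adding a vertex (the hub) adjacent to all rim vertices; for the wheel with three spokes ($K_4$) any vertex may be regarded as the hub. For an edge $ab$ and a vertex $x\notin\{a,b\}$, a vertex-to-edge bridging on $\{x,ab\}$ subdivides $ab$ with a new vertex $y$ and adds the edge $xy$. A graph is $3$-connected if it has more than $3$ vertices and no vertex cut of size less than $3$; it is super-minimally $3$-connected if it is $3$-connected and no proper subgraph is $3$-connected. -}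

module Defs where

open import Data.Bool using (Bool; true; false; _∧_; _∨_; not)
open import Data.Bool.Properties using (∨-comm)
open import Data.Nat using (ℕ; zero; suc; _+_; _<_; _≡ᵇ_)
open import Data.Fin using (Fin; zero; suc; toℕ; _≟_)
open import Data.Fin.Subset using (Subset; _∈_; _∉_; ∣_∣; ⊤)
open import Data.List using (List; length)
open import Data.List.Relation.Unary.All using (All)
open import Data.List.Membership.Propositional using () renaming (_∉_ to _∉ₗ_)
open import Data.Product using (Σ; Σ-syntax; _×_; _,_)
open import Data.Sum using (_⊎_)
open import Relation.Nullary using (¬_; yes; no)
open import Relation.Nullary.Decidable using (⌊_⌋)
open import Relation.Binary.PropositionalEquality using (_≡_; refl; cong₂)
open import Function.Bundles using (_↔_; Inverse)

record Graph : Set where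
  field
    n      : ℕ
    adj    : Fin n → Fin n → Bool
    sym    : ∀ u v → adj u v ≡ adj v u
    irrefl : ∀ v → adj v v ≡ false
open Graph public

_==_ : ∀ {k} → Fin k → Fin k → Bool
u == v = ⌊ u ≟ v ⌋

==-refl : ∀ {k} (v : Fin k) → (v == v) ≡ true
==-refl v with v ≟ v
... | yes _ = refl
... | no ¬p = Data.Empty.⊥-elim (¬p refl)
  where import Data.Empty

fromRel : (k : ℕ) → (Fin k → Fin k → Bool) → Graph
fromRel k r = record
  { n = k
  ; adj = λ u v → not (u == v) ∧ (r u v ∨ r v u)
  ; sym = λ u v → cong₂ (λ p q → not p ∧ q) (eq u v) (∨-comm (r u v) (r v u))
  ; irrefl = λ v → cong₂ (λ p q → not p ∧ q) (==-refl v) refl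
  }
  where
  eq : ∀ u v → (u == v) ≡ (v == u)
  eq u v with u ≟ v | v ≟ u
  ... | yes _ | yes _ = refl
  ... | no _  | no _  = refl
  ... | yes p | no ¬q = Data.Empty.⊥-elim (¬q (Relation.Binary.PropositionalEquality.sym p))
    where import Data.Empty
  ... | no ¬p | yes q = Data.Empty.⊥-elim (¬p (Relation.Binary.PropositionalEquality.sym q))
    where import Data.Empty

-- Wheels.  Wheel m is the wheel with (3 + m) spokes: vertex zero is the
-- hub, vertices suc i (i : Fin (3 + m)) form the rim cycle
-- 0 - 1 - ... - (2+m) - 0.

cycRel : (k : ℕ) → Fin k → Fin k → Bool
cycRel k i j = (suc (toℕ i) ≡ᵇ toℕ j) ∨ ((toℕ i ≡ᵇ 0) ∧ (suc (toℕ j) ≡ᵇ k))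

wheelRel : (m : ℕ) → Fin (suc (3 + m)) → Fin (suc (3 + m)) → Bool
wheelRel m zero    zero    = false
wheelRel m zero    (suc _) = true
wheelRel m (suc _) zero    = true
wheelRel m (suc i) (suc j) = cycRel (3 + m) i j

Wheel : ℕ → Graph
Wheel m = fromRel (suc (3 + m)) (wheelRel m)

hub : (m : ℕ) → Fin (Graph.n (Wheel m))
hub m = zero

record _≅_ (G H : Graph) : Set where
  field
    bij  : Fin (n G) ↔ Fin (n H)
    pres : ∀ u v → adj H (Inverse.to bij u) (Inverse.to bij v) ≡ adj G u v
open _≅_ public

IsWheel : Graph → Set
IsWheel G = Σ ℕ λ m → G ≅ Wheel m

IsRimEdge : (m : ℕ) → Fin (Graph.n (Wheel m)) → Fin (Graph.n (Wheel m)) → Set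
IsRimEdge m u v =
  Σ (Fin (3 + m)) λ i → Σ (Fin (3 + m)) λ j →
    u ≡ suc i × v ≡ suc j × adj (Wheel m) u v ≡ true

-- "x is the hub of G and ab is a rim edge of G": for some wheel
-- structure of G (for K4 any vertex may be regarded as the hub).
HubAndRimEdge : (G : Graph) → Fin (n G) → Fin (n G) → Fin (n G) → Set
HubAndRimEdge G x a b =
  Σ ℕ λ m → Σ (G ≅ Wheel m) λ φ →
    Inverse.to (bij φ) x ≡ hub m ×
    IsRimEdge m (Inverse.to (bij φ) a) (Inverse.to (bij φ) b)

-- Vertex-to-edge bridging on {x, ab}: the new vertex y is `zero`,
-- old vertex v becomes `suc v`.

bridgeRel : (G : Graph) → Fin (n G) → Fin (n G) → Fin (n G) →
            Fin (suc (n G)) → Fin (suc (n G)) → Bool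
bridgeRel G x a b zero    zero    = false
bridgeRel G x a b zero    (suc v) = (v == a) ∨ (v == b) ∨ (v == x)
bridgeRel G x a b (suc u) zero    = false
bridgeRel G x a b (suc u) (suc v) =
  adj G u v ∧ not (((u == a) ∧ (v == b)) ∨ ((u == b) ∧ (v == a)))

bridge : (G : Graph) → Fin (n G) → Fin (n G) → Fin (n G) → Graph
bridge G x a b = fromRel (suc (n G)) (bridgeRel G x a b)

record Subgraph (G : Graph) : Set where
  field
    vs    : Subset (n G)
    es    : Fin (n G) → Fin (n G) → Bool
    es-sym : ∀ u v → es u v ≡ es v u
    es⊆   : ∀ u v → es u v ≡ true → adj G u v ≡ true
    ends  : ∀ u v → es u v ≡ true → u ∈ vs × v ∈ vs
open Subgraph public

whole : (G : Graph) → Subgraph G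
whole G = record
  { vs = ⊤ ; es = adj G ; es-sym = sym G ; es⊆ = λ _ _ e → e
  ; ends = λ _ _ _ → Data.Fin.Subset.Properties.∈⊤ , Data.Fin.Subset.Properties.∈⊤ }
  where import Data.Fin.Subset.Properties

Proper : {G : Graph} → Subgraph G → Set
Proper {G} H =
  (Σ (Fin (n G)) λ v → v ∉ vs H) ⊎
  (Σ (Fin (n G)) λ u → Σ (Fin (n G)) λ v → adj G u v ≡ true × es H u v ≡ false)

data Walk {k : ℕ} (E : Fin k → Fin k → Bool) (P : Fin k → Set) :
          Fin k → Fin k → Set where
  here : ∀ {u} → P u → Walk E P u u
  step : ∀ {u w v} → P u → E u w ≡ true → Walk E P w v → Walk E P u v

ThreeConnectedSub : {G : Graph} → Subgraph G → Set
ThreeConnectedSub {G} H =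
  3 < ∣ vs H ∣ ×
  (∀ (X : List (Fin (n G))) → length X < 3 → All (_∈ vs H) X →
     ∀ u v → u ∈ vs H → v ∈ vs H → u ∉ₗ X → v ∉ₗ X →
     Walk (es H) (λ w → w ∈ vs H × w ∉ₗ X) u v)

ThreeConnected : Graph → Set
ThreeConnected G = ThreeConnectedSub (whole G)

SuperMinimal3Connected : Graph → Set
SuperMinimal3Connected G =
  ThreeConnected G ×
  (∀ (H : Subgraph G) → Proper H → ¬ ThreeConnectedSub H)

{-# OPTIONS --safe #-}
module Submission where

-- Call y the vertex subdividing ab.  If x is the hub and ab a rim edge, y just lengthens the
-- rim, so the bridged graph is a wheel with one more spoke.  Wheels are super-minimally
-- 3-connected: in a 3-connected subgraph every vertex keeps degree at least three, so a rim
-- vertex keeps its three edges, and this spreads around the rim to the whole wheel.  If x is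
-- a rim vertex of a wheel with at least four spokes, deleting the spoke at x leaves a proper
-- 3-connected subgraph: a separator of at most two vertices either misses the hub, which reaches
-- every vertex, or contains it together with at most one vertex of the rim cycle, which then
-- stays connected and keeps y attached.  In K4 every vertex is a hub.

open import Defs hiding (sym)
open import Data.Bool using (Bool; true; false; _∧_; _∨_; not)
import Data.Bool as Bool
open import Data.Bool.Properties using (T-≡; ⇔→≡; ∨-comm; ∨-assoc; ∧-comm)
open import Data.Empty using (⊥; ⊥-elim)
open import Data.Fin using (Fin; zero; suc; toℕ; _≟_; fromℕ; fromℕ<; inject₁)
open import Data.Fin.Permutation using (Permutation; permutation; lift₀; transpose; _⟨$⟩ʳ_; _⟨$⟩ˡ_; inverseˡ)
import Data.Fin.Permutation as Perm
open import Data.Fin.Properties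
  using (suc-injective; toℕ-injective; toℕ<n; toℕ-fromℕ; toℕ-fromℕ<; toℕ-inject₁; any?; all?; pigeonhole)
open import Data.Fin.Subset using (Subset; _∈_; _∉_; ∣_∣; ⊤; _-_)
import Data.Fin.Subset.Properties as SubsetProps
open import Data.Fin.Subset.Properties
  using (∈⊤; ∣⊤∣≡n; x∈p⇒∣p-x∣<∣p∣; x∈p∧x≢y⇒x∈p-y)
open import Data.List using (List; []; _∷_; length; map; filter) renaming (lookup to lookupₗ)
open import Data.List.Properties using (length-map; length-filter; filter-notAll)
open import Data.List.Relation.Unary.All using (All)
import Data.List.Relation.Unary.All as All
open import Data.List.Relation.Unary.All.Properties using (map⁺; all-filter)
open import Data.List.Relation.Unary.Any using (here; there)
open import Data.List.Relation.Unary.Any.Properties using (lookup-index)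
import Data.List.Relation.Unary.Any as Any
open import Data.List.Membership.Propositional using () renaming (_∈_ to _∈ₗ_; _∉_ to _∉ₗ_)
open import Data.List.Membership.Propositional.Properties using (∈-map⁺; ∈-map⁻; ∈-filter⁺; ∈-filter⁻)
open import Data.Nat using (ℕ; zero; suc; _+_; _∸_; _≤_; _<_; z≤n; s≤s; _≤?_; _<?_; _≡ᵇ_) renaming (_≟_ to _≟ℕ_)
open import Data.Nat.Properties
  using ( ≤-refl; ≤-reflexive; ≤-trans; ≤-antisym; ≤-pred; n≤1+n; n<1+n; <-≤-trans; ≤-<-trans; ≤∧≢⇒<; m≤n⇒m<n∨m≡n; <-irrefl; <⇒≢; <⇒≤; ≮⇒≥; ≰⇒>
        ; ≡ᵇ⇒≡; ≡⇒≡ᵇ; +-identityʳ; +-suc; +-cancelˡ-<; m+[n∸m]≡n; m∸n+n≡m; m∸n≤m; m+1+n≢m)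
  renaming (suc-injective to suc-injectiveℕ)
open import Data.Product using (Σ; ∃; _×_; _,_; proj₁; proj₂)
open import Data.Sum using (_⊎_; inj₁; inj₂; [_,_])
open import Data.Vec using (_∷_; tabulate; lookup)
import Data.Vec.Base as Vec
open import Data.Vec.Properties using ([]=⇒lookup; lookup⇒[]=; lookup∘tabulate)
open import Function using (_∘_; case_of_; _⇔_; mk⇔; Equivalence; Inverse; Injective)
open import Function.Properties.Inverse using (↔-sym; ↔-trans)
open import Function.Construct.Composition using (_⇔-∘_)
open import Function.Construct.Symmetry using (⇔-sym)
open import Relation.Nullary using (¬_; Dec; yes; no; ¬?; _×-dec_)
open import Relation.Nullary.Decidable using (toWitness; from-yes; decidable-stable)
open import Relation.Binary.PropositionalEquality
  using (_≡_; _≢_; refl; sym; trans; cong; cong₂; subst; subst₂; ≢-sym; module ≡-Reasoning)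

private
  variable
    k k′ : ℕ

∧-true : ∀ {p q} → p ≡ true → q ≡ true → p ∧ q ≡ true
∧-true refl refl = refl

∧-trueˡ : ∀ {p q} → p ∧ q ≡ true → p ≡ true
∧-trueˡ {true} _ = refl

∧-trueʳ : ∀ {p q} → p ∧ q ≡ true → q ≡ true
∧-trueʳ {true} e = e

∨-trueˡ : ∀ {p} q → p ≡ true → p ∨ q ≡ true
∨-trueˡ _ refl = refl

∨-trueʳ : ∀ p {q} → q ≡ true → p ∨ q ≡ true
∨-trueʳ false e = e
∨-trueʳ true  _ = refl

∨-true⁻ : ∀ {p q} → p ∨ q ≡ true → p ≡ true ⊎ q ≡ true
∨-true⁻ {true}  _ = inj₁ refl
∨-true⁻ {false} e = inj₂ e

∨-trueˡ⁻ : ∀ {p} → p ∨ false ≡ true → p ≡ true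
∨-trueˡ⁻ {true} _ = refl

∨-false : ∀ {p q} → p ≢ true → q ≢ true → p ∨ q ≡ false
∨-false {true}          p≢ _  = ⊥-elim (p≢ refl)
∨-false {false} {true}  _  q≢ = ⊥-elim (q≢ refl)
∨-false {false} {false} _  _  = refl

not-false : ∀ {p} → p ≡ false → not p ≡ true
not-false refl = refl

not-true⁻ : ∀ {p} → not p ≡ true → p ≡ false
not-true⁻ {false} _ = refl

true≢false : ∀ {p} → p ≡ true → p ≢ false
true≢false refl ()

==⇒≡ : {u v : Fin k} → (u == v) ≡ true → u ≡ v
==⇒≡ {u = u} {v} e = toWitness {a? = u ≟ v} (Equivalence.from T-≡ e)

≡⇒== : {u v : Fin k} → u ≡ v → (u == v) ≡ true
≡⇒== {u = u} refl = ==-refl u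

≢⇒== : {u v : Fin k} → u ≢ v → (u == v) ≡ false
≢⇒== {u = u} {v} u≢v with u ≟ v
... | yes u≡v = ⊥-elim (u≢v u≡v)
... | no _    = refl

==-injective : (f : Fin k → Fin k′) → Injective _≡_ _≡_ f → ∀ u v → (f u == f v) ≡ (u == v)
==-injective f f-inj u v with u ≟ v
... | yes refl = ==-refl (f u)
... | no u≢v   = ≢⇒== (u≢v ∘ f-inj)

fromRel-adj⁺ : (r : Fin k → Fin k → Bool) {u v : Fin k} → u ≢ v →
               r u v ≡ true ⊎ r v u ≡ true → adj (fromRel k r) u v ≡ true
fromRel-adj⁺ r u≢v (inj₁ e) = ∧-true (not-false (≢⇒== u≢v)) (∨-trueˡ _ e)
fromRel-adj⁺ r u≢v (inj₂ e) = ∧-true (not-false (≢⇒== u≢v)) (∨-trueʳ _ e)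

adj⇒≢ : (G : Graph) {u v : Fin (n G)} → adj G u v ≡ true → u ≢ v
adj⇒≢ G {u} e refl = true≢false e (irrefl G u)

module _ {E : Fin k → Fin k → Bool} {P : Fin k → Set} where

  source-allowed : ∀ {u v} → Walk E P u v → P u
  source-allowed (here p)     = p
  source-allowed (step p _ _) = p

  _++ʷ_ : ∀ {u w v} → Walk E P u w → Walk E P w v → Walk E P u v
  here _       ++ʷ q = q
  step p e w   ++ʷ q = step p e (w ++ʷ q)

  edgeʷ : ∀ {u v} → P u → P v → E u v ≡ true → Walk E P u v
  edgeʷ pu pv e = step pu e (here pv)

  module _ (E-sym : ∀ u v → E u v ≡ E v u) where

    reverseʷ : ∀ {u v} → Walk E P u v → Walk E P v u
    reverseʷ (here p)                = here p
    reverseʷ (step {u} {w} p e rest) =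
      reverseʷ rest ++ʷ edgeʷ (source-allowed rest) p (trans (E-sym w u) e)

    connected-via : ∀ r → (∀ u → P u → Walk E P u r) → ∀ u v → P u → P v → Walk E P u v
    connected-via r to-r u v pu pv = to-r u pu ++ʷ reverseʷ (to-r v pv)

mapʷ : ∀ {k′} {E : Fin k → Fin k → Bool} {P : Fin k → Set}
       {E′ : Fin k′ → Fin k′ → Bool} {P′ : Fin k′ → Set} (f : Fin k → Fin k′) →
       (∀ {u w} → E u w ≡ true → E′ (f u) (f w) ≡ true) → (∀ {u} → P u → P′ (f u)) →
       ∀ {u v} → Walk E P u v → Walk E′ P′ (f u) (f v)
mapʷ f f-E f-P (here p)     = here (f-P p)
mapʷ f f-E f-P (step p e w) = step (f-P p) (f-E e) (mapʷ f f-E f-P w)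

Embedding : ℕ → Subset k → Set
Embedding {k} m p = Σ (Fin m → Fin k) λ f → Injective _≡_ _≡_ f × (∀ i → f i ∈ p)

≤∣p∣⇒embedding : ∀ {m} (p : Subset k) → m ≤ ∣ p ∣ → Embedding m p
≤∣p∣⇒embedding {m = zero} p _ = (λ ()) , (λ {i} → case i of λ ()) , λ ()
≤∣p∣⇒embedding {m = suc m} (false ∷ p) m<∣p∣ with ≤∣p∣⇒embedding p m<∣p∣
... | f , f-inj , f∈ = suc ∘ f , f-inj ∘ suc-injective , Vec.there ∘ f∈
≤∣p∣⇒embedding {k = suc k} {m = suc m} (true ∷ p) (s≤s m≤∣p∣) with ≤∣p∣⇒embedding p m≤∣p∣
... | f , f-inj , f∈ = g , g-inj , g∈
  where
  g : Fin (suc m) → Fin (suc k)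
  g zero    = zero
  g (suc i) = suc (f i)
  g-inj : Injective _≡_ _≡_ g
  g-inj {zero}  {zero}  _ = refl
  g-inj {suc i} {suc j} e = cong suc (f-inj (suc-injective e))
  g∈ : ∀ i → g i ∈ true ∷ p
  g∈ zero    = Vec.here
  g∈ (suc i) = Vec.there (f∈ i)

embedding⇒≤∣p∣ : ∀ {m} (p : Subset k) → Embedding m p → m ≤ ∣ p ∣
embedding⇒≤∣p∣ {m = zero}  p _                = z≤n
embedding⇒≤∣p∣ {m = suc m} p (f , f-inj , f∈) =
  <-≤-trans (s≤s (embedding⇒≤∣p∣ (p - f zero) (f ∘ suc , suc-injective ∘ f-inj , f∈-p-f0)))
            (x∈p⇒∣p-x∣<∣p∣ (f∈ zero))
  where
  f∈-p-f0 : ∀ i → f (suc i) ∈ p - f zero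
  f∈-p-f0 i = x∈p∧x≢y⇒x∈p-y (f∈ (suc i)) (λ e → case f-inj e of λ ())

injection⇒∣p∣≤∣q∣ : (p : Subset k) (q : Subset k′) (g : Fin k → Fin k′) → Injective _≡_ _≡_ g →
                    (∀ {v} → v ∈ p → g v ∈ q) → ∣ p ∣ ≤ ∣ q ∣
injection⇒∣p∣≤∣q∣ p q g g-inj g∈ with ≤∣p∣⇒embedding p ≤-refl
... | f , f-inj , f∈ = embedding⇒≤∣p∣ q (g ∘ f , f-inj ∘ g-inj , g∈ ∘ f∈)

list-pigeonhole : (L : List (Fin k)) (f : Fin (suc (length L)) → Fin k) → Injective _≡_ _≡_ f →
                  ∃ λ i → f i ∉ₗ L
list-pigeonhole L f f-inj with any? (λ i → ¬? (Any.any? (f i ≟_) L))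
... | yes found = found
... | no none   = case pigeonhole (n<1+n (length L)) (Any.index ∘ f∈L) of λ where
    (i , j , i<j , same-index) → ⊥-elim (<⇒≢ i<j (cong toℕ (f-inj (begin
      f i                           ≡⟨ lookup-index (f∈L i) ⟩
      lookupₗ L (Any.index (f∈L i)) ≡⟨ cong (lookupₗ L) same-index ⟩
      lookupₗ L (Any.index (f∈L j)) ≡⟨ lookup-index (f∈L j) ⟨
      f j                           ∎))))
  where
  open ≡-Reasoning
  f∈L : ∀ i → f i ∈ₗ L
  f∈L i = decidable-stable (Any.any? (f i ≟_) L) (λ f∉ → none (i , f∉))

length<∣p∣⇒∃∉ : (p : Subset k) (L : List (Fin k)) → length L < ∣ p ∣ → ∃ λ v → v ∈ p × v ∉ₗ L
length<∣p∣⇒∃∉ p L L<∣p∣ with ≤∣p∣⇒embedding p L<∣p∣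
... | f , f-inj , f∈ with list-pigeonhole L f f-inj
...   | i , fi∉L = f i , f∈ i , fi∉L

NoSmallSeparator : {G : Graph} → Subgraph G → Set
NoSmallSeparator {G} H =
  ∀ (X : List (Fin (n G))) → length X < 3 → All (_∈ vs H) X →
    ∀ u v → u ∈ vs H → v ∈ vs H → u ∉ₗ X → v ∉ₗ X →
    Walk (es H) (λ w → w ∈ vs H × w ∉ₗ X) u v

module Iso {G H : Graph} (φ : G ≅ H) where
  open Inverse (bij φ) public using (to; from; strictlyInverseˡ; strictlyInverseʳ)

  to-injective : Injective _≡_ _≡_ to
  to-injective {u} {v} e = trans (sym (strictlyInverseʳ u)) (trans (cong from e) (strictlyInverseʳ v))

  from-injective : Injective _≡_ _≡_ from
  from-injective {u} {v} e = trans (sym (strictlyInverseˡ u)) (trans (cong to e) (strictlyInverseˡ v))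

  pres-from : ∀ u v → adj G (from u) (from v) ≡ adj H u v
  pres-from u v = trans (sym (pres φ (from u) (from v)))
                        (cong₂ (adj H) (strictlyInverseˡ u) (strictlyInverseˡ v))

≅-sym : ∀ {G H} → G ≅ H → H ≅ G
≅-sym φ = record { bij = ↔-sym (bij φ) ; pres = Iso.pres-from φ }

≅-trans : ∀ {G H K} → G ≅ H → H ≅ K → G ≅ K
≅-trans φ ψ = record
  { bij  = ↔-trans (bij φ) (bij ψ)
  ; pres = λ u v → trans (pres ψ (Iso.to φ u) (Iso.to φ v)) (pres φ u v)
  }

preimage : (Fin k → Fin k′) → Subset k′ → Subset k
preimage f p = tabulate (λ v → lookup p (f v))

∈-preimage⁻ : (f : Fin k → Fin k′) (p : Subset k′) {v : Fin k} → v ∈ preimage f p → f v ∈ p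
∈-preimage⁻ f p {v} v∈ =
  lookup⇒[]= (f v) p (trans (sym (lookup∘tabulate (λ w → lookup p (f w)) v)) ([]=⇒lookup v∈))

∈-preimage⁺ : (f : Fin k → Fin k′) (p : Subset k′) {v : Fin k} → f v ∈ p → v ∈ preimage f p
∈-preimage⁺ f p {v} fv∈ =
  lookup⇒[]= v (preimage f p) (trans (lookup∘tabulate (λ w → lookup p (f w)) v) ([]=⇒lookup fv∈))

record Corresponding {G H : Graph} (φ : G ≅ H) (K : Subgraph G) (L : Subgraph H) : Set where
  open Iso φ
  field
    vs⁺     : ∀ {v} → v ∈ vs K → to v ∈ vs L
    vs⁻     : ∀ {v} → to v ∈ vs L → v ∈ vs K
    es-pres : ∀ u v → es L (to u) (to v) ≡ es K u v

module _ {G H : Graph} {φ : G ≅ H} {K : Subgraph G} {L : Subgraph H} (c : Corresponding φ K L) where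
  open Iso φ
  open Corresponding c

  ThreeConnectedSub-reflect : ThreeConnectedSub L → ThreeConnectedSub K
  ThreeConnectedSub-reflect (3<∣L∣ , walksL) =
    <-≤-trans 3<∣L∣ (injection⇒∣p∣≤∣q∣ (vs L) (vs K) from from-injective from∈) , walksK
    where
    from∈ : ∀ {v} → v ∈ vs L → from v ∈ vs K
    from∈ {v} v∈ = vs⁻ (subst (_∈ vs L) (sym (strictlyInverseˡ v)) v∈)

    from-es : ∀ {a b} → es L a b ≡ true → es K (from a) (from b) ≡ true
    from-es {a} {b} e = trans (sym (es-pres (from a) (from b)))
                              (trans (cong₂ (es L) (strictlyInverseˡ a) (strictlyInverseˡ b)) e)

    to∉ : ∀ X {u} → u ∉ₗ X → to u ∉ₗ map to X
    to∉ X u∉ m with ∈-map⁻ to m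
    ... | z , z∈ , e = u∉ (subst (_∈ₗ X) (sym (to-injective e)) z∈)

    from∉ : ∀ X {w} → w ∉ₗ map to X → from w ∉ₗ X
    from∉ X {w} w∉ m = w∉ (subst (_∈ₗ map to X) (strictlyInverseˡ w) (∈-map⁺ to m))

    walksK : NoSmallSeparator K
    walksK X ∣X∣<3 X⊆K u v u∈ v∈ u∉ v∉ =
      subst₂ (Walk (es K) _) (strictlyInverseʳ u) (strictlyInverseʳ v)
        (mapʷ from from-es (λ (w∈ , w∉) → from∈ w∈ , from∉ X w∉)
          (walksL (map to X) (subst (_< 3) (sym (length-map to X)) ∣X∣<3) (map⁺ (All.map vs⁺ X⊆K))
                  (to u) (to v) (vs⁺ u∈) (vs⁺ v∈) (to∉ X u∉) (to∉ X v∉)))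

whole-corresponding : ∀ {G H} (φ : G ≅ H) → Corresponding φ (whole G) (whole H)
whole-corresponding φ = record { vs⁺ = λ _ → ∈⊤ ; vs⁻ = λ _ → ∈⊤ ; es-pres = pres φ }

pullback : ∀ {G H} → G ≅ H → Subgraph H → Subgraph G
pullback {G} {H} φ L = record
  { vs     = preimage to (vs L)
  ; es     = λ u v → es L (to u) (to v)
  ; es-sym = λ u v → es-sym L (to u) (to v)
  ; es⊆    = λ u v e → trans (sym (pres φ u v)) (es⊆ L (to u) (to v) e)
  ; ends   = λ u v e → ∈-preimage⁺ to (vs L) (proj₁ (ends L (to u) (to v) e))
                     , ∈-preimage⁺ to (vs L) (proj₂ (ends L (to u) (to v) e))
  }
  where open Iso φ

pullback-corresponding : ∀ {G H} (φ : G ≅ H) (L : Subgraph H) → Corresponding φ (pullback φ L) L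
pullback-corresponding φ L = record
  { vs⁺ = ∈-preimage⁻ (Iso.to φ) (vs L) ; vs⁻ = ∈-preimage⁺ (Iso.to φ) (vs L) ; es-pres = λ _ _ → refl }

pullback-proper : ∀ {G H} (φ : G ≅ H) (L : Subgraph H) → Proper L → Proper (pullback φ L)
pullback-proper φ L (inj₁ (v , v∉)) =
  inj₁ (from v , λ m → v∉ (subst (_∈ vs L) (strictlyInverseˡ v) (∈-preimage⁻ to (vs L) m)))
  where open Iso φ
pullback-proper φ L (inj₂ (u , v , uv∈H , uv∉L)) =
  inj₂ (from u , from v , trans (pres-from u v) uv∈H
       , trans (cong₂ (es L) (strictlyInverseˡ u) (strictlyInverseˡ v)) uv∉L)
  where open Iso φ

SuperMinimal3Connected-transport : ∀ {G H} → G ≅ H → SuperMinimal3Connected G → SuperMinimal3Connected H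
SuperMinimal3Connected-transport φ (3conG , minimalG) =
  ThreeConnectedSub-reflect (whole-corresponding (≅-sym φ)) 3conG ,
  λ L L-proper 3conL → minimalG (pullback φ L) (pullback-proper φ L L-proper)
                                (ThreeConnectedSub-reflect (pullback-corresponding φ L) 3conL)

⟨$⟩ʳ-injective : (π : Permutation k k′) → Injective _≡_ _≡_ (π ⟨$⟩ʳ_)
⟨$⟩ʳ-injective π {u} {v} e = trans (sym (inverseˡ π)) (trans (cong (π ⟨$⟩ˡ_) e) (inverseˡ π))

symmetrise : (Fin k → Fin k → Bool) → Fin k → Fin k → Bool
symmetrise r u v = r u v ∨ r v u

fromRel-≅ : (r : Fin k → Fin k → Bool) (r′ : Fin k′ → Fin k′ → Bool) (π : Permutation k k′) →
            (∀ u v → u ≢ v → symmetrise r′ (π ⟨$⟩ʳ u) (π ⟨$⟩ʳ v) ≡ symmetrise r u v) →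
            fromRel k r ≅ fromRel k′ r′
fromRel-≅ r r′ π same = record { bij = π ; pres = pres′ }
  where
  pres′ : ∀ u v → adj (fromRel _ r′) (π ⟨$⟩ʳ u) (π ⟨$⟩ʳ v) ≡ adj (fromRel _ r) u v
  pres′ u v with u ≟ v
  ... | yes refl rewrite ==-refl (π ⟨$⟩ʳ u) = refl
  ... | no u≢v   = cong₂ (λ p q → not p ∧ q) (≢⇒== (u≢v ∘ ⟨$⟩ʳ-injective π)) (same u v u≢v)

bridge-≅ : ∀ {G H} (φ : G ≅ H) {x a b x′ a′ b′} →
           Iso.to φ x ≡ x′ → Iso.to φ a ≡ a′ → Iso.to φ b ≡ b′ → bridge G x a b ≅ bridge H x′ a′ b′
bridge-≅ {G} {H} φ {x} {a} {b} refl refl refl =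
  fromRel-≅ _ _ (lift₀ (bij φ)) (λ u v _ → cong₂ _∨_ (same u v) (same v u))
  where
  open Iso φ
  to== : ∀ u v → (to u == to v) ≡ (u == v)
  to== = ==-injective to to-injective
  same : ∀ u v → bridgeRel H (to x) (to a) (to b) (lift₀ (bij φ) ⟨$⟩ʳ u) (lift₀ (bij φ) ⟨$⟩ʳ v)
                 ≡ bridgeRel G x a b u v
  same zero    zero    = refl
  same zero    (suc v) = cong₂ _∨_ (to== v a) (cong₂ _∨_ (to== v b) (to== v x))
  same (suc u) zero    = refl
  same (suc u) (suc v) =
    cong₂ (λ p q → p ∧ not q) (pres φ u v)
          (cong₂ _∨_ (cong₂ _∧_ (to== u a) (to== v b)) (cong₂ _∧_ (to== u b) (to== v a)))

bridge-comm : ∀ G (x a b : Fin (n G)) → bridge G x a b ≅ bridge G x b a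
bridge-comm G x a b = fromRel-≅ _ _ Perm.id (λ u v _ → cong₂ _∨_ (same u v) (same v u))
  where
  swap₃ : ∀ p q r → p ∨ q ∨ r ≡ q ∨ p ∨ r
  swap₃ p q r = trans (sym (∨-assoc p q r)) (trans (cong (_∨ r) (∨-comm p q)) (∨-assoc q p r))
  same : ∀ u v → bridgeRel G x b a u v ≡ bridgeRel G x a b u v
  same zero    zero    = refl
  same zero    (suc v) = swap₃ (v == b) (v == a) (v == x)
  same (suc u) zero    = refl
  same (suc u) (suc v) = cong (λ p → adj G u v ∧ not p) (∨-comm ((u == b) ∧ (v == a)) ((u == a) ∧ (v == b)))

module Cyclic (K : ℕ) where

  private
    next′ : (t : Fin (suc K)) → Dec (suc (toℕ t) < suc K) → Fin (suc K)
    next′ t (yes t<K) = fromℕ< t<K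
    next′ t (no _)    = zero

  next : Fin (suc K) → Fin (suc K)
  next t = next′ t (suc (toℕ t) <? suc K)

  prev : Fin (suc K) → Fin (suc K)
  prev zero    = fromℕ K
  prev (suc t) = inject₁ t

  next-spec : ∀ t → (toℕ t < K × toℕ (next t) ≡ suc (toℕ t)) ⊎ (toℕ t ≡ K × next t ≡ zero)
  next-spec t with suc (toℕ t) <? suc K
  ... | yes t<K = inj₁ (≤-pred t<K , toℕ-fromℕ< t<K)
  ... | no  t≮K = inj₂ (≤-antisym (≤-pred (toℕ<n t)) (≮⇒≥ (t≮K ∘ s≤s)) , refl)

  toℕ-next≡zero : ∀ t → next t ≡ zero → toℕ t ≡ K
  toℕ-next≡zero t e with next-spec t
  ... | inj₁ (_ , e′) = case trans (sym e′) (cong toℕ e) of λ ()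
  ... | inj₂ (t≡K , _) = t≡K

  next∘prev : ∀ t → next (prev t) ≡ t
  next∘prev zero with next-spec (fromℕ K)
  ... | inj₁ (K<K , _) = ⊥-elim (<-irrefl (toℕ-fromℕ K) K<K)
  ... | inj₂ (_ , e)   = e
  next∘prev (suc t) with next-spec (inject₁ t)
  ... | inj₁ (_ , e)   = toℕ-injective (trans e (cong suc (toℕ-inject₁ t)))
  ... | inj₂ (t≡K , _) = ⊥-elim (<-irrefl (trans (sym (toℕ-inject₁ t)) t≡K) (toℕ<n t))

  prev∘next : ∀ t → prev (next t) ≡ t
  prev∘next t with next t | next-spec t
  ... | suc u | inj₁ (_ , e)    = toℕ-injective (trans (toℕ-inject₁ u) (suc-injectiveℕ e))
  ... | zero  | inj₂ (t≡K , _)  = toℕ-injective (trans (toℕ-fromℕ K) (sym t≡K))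
  ... | zero  | inj₁ (_ , ())

  next-injective : Injective _≡_ _≡_ next
  next-injective {u} {v} e = trans (sym (prev∘next u)) (trans (cong prev e) (prev∘next v))

  next^ : ℕ → Fin (suc K) → Fin (suc K)
  next^ zero    t = t
  next^ (suc j) t = next (next^ j t)

  next^-+ : ∀ i j t → next^ (i + j) t ≡ next^ i (next^ j t)
  next^-+ zero    j t = refl
  next^-+ (suc i) j t = cong next (next^-+ i j t)

  next^-next : ∀ j t → next^ j (next t) ≡ next (next^ j t)
  next^-next zero    t = refl
  next^-next (suc j) t = cong next (next^-next j t)

  next^-injective : ∀ j → Injective _≡_ _≡_ (next^ j)
  next^-injective zero    e = e
  next^-injective (suc j) e = next^-injective j (next-injective e)

  toℕ-next^ : ∀ j t → toℕ t + j ≤ K → toℕ (next^ j t) ≡ toℕ t + j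
  toℕ-next^ zero    t _ = sym (+-identityʳ (toℕ t))
  toℕ-next^ (suc j) t t+j<K = from-spec (next-spec (next^ j t))
    where
    t+j≤K : toℕ t + j ≤ K
    t+j≤K = ≤-trans (n≤1+n _) (subst (_≤ K) (+-suc (toℕ t) j) t+j<K)
    from-spec : (toℕ (next^ j t) < K × toℕ (next (next^ j t)) ≡ suc (toℕ (next^ j t))) ⊎
                (toℕ (next^ j t) ≡ K × next (next^ j t) ≡ zero) →
                toℕ (next^ (suc j) t) ≡ toℕ t + suc j
    from-spec (inj₁ (_ , e)) = trans e (trans (cong suc (toℕ-next^ j t t+j≤K)) (sym (+-suc (toℕ t) j)))
    from-spec (inj₂ (e , _)) =
      ⊥-elim (<-irrefl (trans (sym (toℕ-next^ j t t+j≤K)) e) (subst (_≤ K) (+-suc (toℕ t) j) t+j<K))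

  toℕ-next^-zero : ∀ j → j ≤ K → toℕ (next^ j zero) ≡ j
  toℕ-next^-zero j = toℕ-next^ j zero

  next^-zero-injective : ∀ j j′ → j ≤ K → j′ ≤ K → next^ j zero ≡ next^ j′ zero → j ≡ j′
  next^-zero-injective j j′ j≤K j′≤K e =
    trans (sym (toℕ-next^-zero j j≤K)) (trans (cong toℕ e) (toℕ-next^-zero j′ j′≤K))

  next^-zero : ∀ r → next^ (toℕ r) zero ≡ r
  next^-zero r = toℕ-injective (toℕ-next^-zero (toℕ r) (≤-pred (toℕ<n r)))

  next^-wrap : ∀ t → next^ (suc (K ∸ toℕ t)) t ≡ zero
  next^-wrap t with next-spec (next^ (K ∸ toℕ t) t)
  ... | inj₁ (<K , _) = ⊥-elim (<-irrefl (trans (toℕ-next^ _ t (≤-reflexive t+i≡K)) t+i≡K) <K)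
    where
    t+i≡K : toℕ t + (K ∸ toℕ t) ≡ K
    t+i≡K = m+[n∸m]≡n (≤-pred (toℕ<n t))
  ... | inj₂ (_ , e)  = e

  next^-reaches : ∀ t r → next^ (toℕ r + suc (K ∸ toℕ t)) t ≡ r
  next^-reaches t r = begin
    next^ (toℕ r + suc (K ∸ toℕ t)) t        ≡⟨ next^-+ (toℕ r) _ t ⟩
    next^ (toℕ r) (next^ (suc (K ∸ toℕ t)) t) ≡⟨ cong (next^ (toℕ r)) (next^-wrap t) ⟩
    next^ (toℕ r) zero                         ≡⟨ next^-zero r ⟩
    r                                          ∎
    where open ≡-Reasoning

  next^≢id : ∀ j t → suc j ≤ K → next^ (suc j) t ≢ t
  next^≢id j t 1+j≤K e with toℕ t + suc j ≤? K
  ... | yes fits    = m+1+n≢m (toℕ t) (trans (sym (toℕ-next^ (suc j) t fits)) (cong toℕ e))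
  ... | no overflow = <-irrefl (sym (suc-injectiveℕ 1+K≡1+j)) 1+j≤K
    where
    open ≡-Reasoning
    i : ℕ
    i = K ∸ toℕ t
    t+i≡K : toℕ t + i ≡ K
    t+i≡K = m+[n∸m]≡n (≤-pred (toℕ<n t))
    i<1+j : suc i ≤ suc j
    i<1+j = +-cancelˡ-< (toℕ t) i (suc j) (subst (_< toℕ t + suc j) (sym t+i≡K) (≰⇒> overflow))
    t≡j-i : toℕ t ≡ j ∸ i
    t≡j-i = begin
      toℕ t                                 ≡⟨ cong toℕ (sym e) ⟩
      toℕ (next^ (suc j) t)                 ≡⟨ cong (λ l → toℕ (next^ l t)) (sym (m∸n+n≡m i<1+j)) ⟩
      toℕ (next^ (j ∸ i + suc i) t)         ≡⟨ cong toℕ (next^-+ (j ∸ i) (suc i) t) ⟩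
      toℕ (next^ (j ∸ i) (next^ (suc i) t)) ≡⟨ cong (toℕ ∘ next^ (j ∸ i)) (next^-wrap t) ⟩
      toℕ (next^ (j ∸ i) zero)              ≡⟨ toℕ-next^-zero (j ∸ i) (≤-trans (m∸n≤m j i) (≤-trans (n≤1+n j) 1+j≤K)) ⟩
      j ∸ i                                 ∎
    1+K≡1+j : suc K ≡ suc j
    1+K≡1+j = begin
      suc K             ≡⟨ cong suc (sym t+i≡K) ⟩
      suc (toℕ t + i)   ≡⟨ sym (+-suc (toℕ t) i) ⟩
      toℕ t + suc i     ≡⟨ cong (_+ suc i) t≡j-i ⟩
      j ∸ i + suc i     ≡⟨ m∸n+n≡m i<1+j ⟩
      suc j             ∎

≡ᵇ-true⁻ : ∀ {a b} → (a ≡ᵇ b) ≡ true → a ≡ b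
≡ᵇ-true⁻ {a} {b} e = ≡ᵇ⇒≡ a b (Equivalence.from T-≡ e)

≡ᵇ-true⁺ : ∀ {a b} → a ≡ b → (a ≡ᵇ b) ≡ true
≡ᵇ-true⁺ {a} {b} e = Equivalence.to T-≡ (≡⇒≡ᵇ a b e)

module WheelRim (m : ℕ) where
  open Cyclic (2 + m) public

  RimAdj : Fin (3 + m) → Fin (3 + m) → Set
  RimAdj i j = j ≡ next i ⊎ i ≡ next j

  RimAdj-sym : ∀ {i j} → RimAdj i j → RimAdj j i
  RimAdj-sym (inj₁ e) = inj₂ e
  RimAdj-sym (inj₂ e) = inj₁ e

  next≢id : ∀ t → next t ≢ t
  next≢id t = next^≢id 0 t (s≤s z≤n)

  next²≢id : ∀ t → next (next t) ≢ t
  next²≢id t = next^≢id 1 t (s≤s (s≤s z≤n))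

  next³≢id : 3 ≤ 2 + m → ∀ t → next (next (next t)) ≢ t
  next³≢id 3≤K t = next^≢id 2 t 3≤K

  prev≢id : ∀ t → prev t ≢ t
  prev≢id t e = next≢id t (trans (cong next (sym e)) (next∘prev t))

  prev≢next : ∀ t → prev t ≢ next t
  prev≢next t e = next²≢id t (trans (cong next (sym e)) (next∘prev t))

  prev²≢id : ∀ t → prev (prev t) ≢ t
  prev²≢id t e = next²≢id t (trans (cong (next ∘ next) (sym e)) (trans (cong next (next∘prev (prev t))) (next∘prev t)))

  prev²≢next : 3 ≤ 2 + m → ∀ t → prev (prev t) ≢ next t
  prev²≢next 3≤K t e =
    next³≢id 3≤K t (trans (cong (next ∘ next) (sym e)) (trans (cong next (next∘prev (prev t))) (next∘prev t)))

  next²≢prev : 3 ≤ 2 + m → ∀ t → next (next t) ≢ prev t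
  next²≢prev 3≤K t e = next³≢id 3≤K t (trans (cong next e) (next∘prev t))

  RimAdj⇒≢ : ∀ {i j} → RimAdj i j → i ≢ j
  RimAdj⇒≢ {i} (inj₁ e) refl = next≢id i (sym e)
  RimAdj⇒≢ {i} (inj₂ e) refl = next≢id i (sym e)

  cycRel⇒RimAdj : ∀ i j → cycRel (3 + m) i j ≡ true → RimAdj i j
  cycRel⇒RimAdj i j e with ∨-true⁻ e | next-spec i | next-spec j
  ... | inj₁ forward | inj₁ (_ , e′) | _ = inj₁ (toℕ-injective (trans (sym (≡ᵇ-true⁻ forward)) (sym e′)))
  ... | inj₁ forward | inj₂ (i≡K , _) | _ =
    ⊥-elim (<-irrefl refl (subst (_< 3 + m) (trans (sym (≡ᵇ-true⁻ forward)) (cong suc i≡K)) (toℕ<n j)))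
  ... | inj₂ wrap | _ | inj₁ (j<K , _) =
    ⊥-elim (<-irrefl (suc-injectiveℕ (≡ᵇ-true⁻ (∧-trueʳ wrap))) j<K)
  ... | inj₂ wrap | _ | inj₂ (_ , next-j≡0) =
    inj₂ (trans (toℕ-injective (≡ᵇ-true⁻ {b = 0} (∧-trueˡ wrap))) (sym next-j≡0))

  RimAdj⇒cycRel : ∀ i j → RimAdj i j → cycRel (3 + m) i j ≡ true ⊎ cycRel (3 + m) j i ≡ true
  RimAdj⇒cycRel i j (inj₁ e) with next-spec i
  ... | inj₁ (_ , e′)          = inj₁ (∨-trueˡ _ (≡ᵇ-true⁺ (sym (trans (cong toℕ e) e′))))
  ... | inj₂ (i≡K , next-i≡0) =
    inj₂ (∨-trueʳ _ (∧-true (≡ᵇ-true⁺ (cong toℕ (trans e next-i≡0))) (≡ᵇ-true⁺ (cong suc i≡K))))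
  RimAdj⇒cycRel i j (inj₂ e) = [ inj₂ , inj₁ ] (RimAdj⇒cycRel j i (inj₁ e))

  cycRel-sym⇔RimAdj : ∀ i j → symmetrise (cycRel (3 + m)) i j ≡ true ⇔ RimAdj i j
  cycRel-sym⇔RimAdj i j = mk⇔
    ([ cycRel⇒RimAdj i j , RimAdj-sym ∘ cycRel⇒RimAdj j i ] ∘ ∨-true⁻)
    ([ ∨-trueˡ (cycRel (3 + m) j i) , ∨-trueʳ (cycRel (3 + m) i j) ] ∘ RimAdj⇒cycRel i j)

  rim-adj⁻ : ∀ i j → adj (Wheel m) (suc i) (suc j) ≡ true → RimAdj i j
  rim-adj⁻ i j e = Equivalence.to (cycRel-sym⇔RimAdj i j) (∧-trueʳ e)

  rim-adj⁺ : ∀ i j → RimAdj i j → adj (Wheel m) (suc i) (suc j) ≡ true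
  rim-adj⁺ i j r = fromRel-adj⁺ (wheelRel m) (RimAdj⇒≢ r ∘ suc-injective) (RimAdj⇒cycRel i j r)

  rim-neighbours : ∀ i v → adj (Wheel m) (suc i) v ≡ true → v ∈ₗ zero ∷ suc (next i) ∷ suc (prev i) ∷ []
  rim-neighbours i zero    _ = here refl
  rim-neighbours i (suc j) e with rim-adj⁻ i j e
  ... | inj₁ j≡next-i = there (here (cong suc j≡next-i))
  ... | inj₂ i≡next-j = there (there (here (cong suc (trans (sym (prev∘next j)) (cong prev (sym i≡next-j))))))

  wheel-automorphism : (π : Permutation (3 + m) (3 + m)) → (∀ t → π ⟨$⟩ʳ next t ≡ next (π ⟨$⟩ʳ t)) →
                       Wheel m ≅ Wheel m
  wheel-automorphism π π-next = fromRel-≅ (wheelRel m) (wheelRel m) (lift₀ π) same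
    where
    π-inj : Injective _≡_ _≡_ (π ⟨$⟩ʳ_)
    π-inj = ⟨$⟩ʳ-injective π
    RimAdj-π : ∀ i j → RimAdj (π ⟨$⟩ʳ i) (π ⟨$⟩ʳ j) ⇔ RimAdj i j
    RimAdj-π i j = mk⇔
      [ (λ e → inj₁ (π-inj (trans e (sym (π-next i))))) , (λ e → inj₂ (π-inj (trans e (sym (π-next j))))) ]
      [ (λ e → inj₁ (trans (cong (π ⟨$⟩ʳ_) e) (π-next i))) , (λ e → inj₂ (trans (cong (π ⟨$⟩ʳ_) e) (π-next j))) ]
    same : ∀ u v → u ≢ v → symmetrise (wheelRel m) (lift₀ π ⟨$⟩ʳ u) (lift₀ π ⟨$⟩ʳ v) ≡ symmetrise (wheelRel m) u v
    same zero    zero    u≢v = ⊥-elim (u≢v refl)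
    same zero    (suc j) _   = refl
    same (suc i) zero    _   = refl
    same (suc i) (suc j) _   =
      ⇔→≡ ((⇔-sym (cycRel-sym⇔RimAdj i j) ⇔-∘ RimAdj-π i j) ⇔-∘ cycRel-sym⇔RimAdj (π ⟨$⟩ʳ i) (π ⟨$⟩ʳ j))

  nextₚ : Permutation (3 + m) (3 + m)
  nextₚ = permutation next prev next∘prev prev∘next

  rotationₚ : ℕ → Permutation (3 + m) (3 + m)
  rotationₚ zero    = Perm.id
  rotationₚ (suc s) = rotationₚ s Perm.∘ₚ nextₚ

  rotationₚ-to : ∀ s t → rotationₚ s ⟨$⟩ʳ t ≡ next^ s t
  rotationₚ-to zero    t = refl
  rotationₚ-to (suc s) t = cong next (rotationₚ-to s t)

  rotation : ℕ → Wheel m ≅ Wheel m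
  rotation s = wheel-automorphism (rotationₚ s) λ t → begin
    rotationₚ s ⟨$⟩ʳ next t   ≡⟨ rotationₚ-to s (next t) ⟩
    next^ s (next t)          ≡⟨ next^-next s t ⟩
    next (next^ s t)          ≡⟨ cong next (rotationₚ-to s t) ⟨
    next (rotationₚ s ⟨$⟩ʳ t) ∎
    where open ≡-Reasoning

  rotation-rim : ∀ s t → Iso.to (rotation s) (suc t) ≡ suc (next^ s t)
  rotation-rim s t = cong suc (rotationₚ-to s t)

  rotate-to-last : Fin (3 + m) → ℕ
  rotate-to-last i = suc (2 + m ∸ toℕ (next i))

  rotated-next≡0 : ∀ i → next (next^ (rotate-to-last i) i) ≡ zero
  rotated-next≡0 i = trans (sym (next^-next (rotate-to-last i) i)) (next^-wrap (next i))

  bridge-rotate-rim-edge : ∀ i {x x′} → Iso.to (rotation (rotate-to-last i)) x ≡ x′ →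
                           bridge (Wheel m) x (suc i) (suc (next i)) ≅
                           bridge (Wheel m) x′ (suc (next^ (rotate-to-last i) i)) (suc zero)
  bridge-rotate-rim-edge i x↦x′ =
    bridge-≅ (rotation s) x↦x′ (rotation-rim s i) (trans (rotation-rim s (next i)) (cong suc (next^-wrap (next i))))
    where
    s : ℕ
    s = rotate-to-last i

K4-complete : ∀ u v → adj (Wheel 0) u v ≡ not (u == v)
K4-complete = from-yes (all? λ u → all? λ v → adj (Wheel 0) u v Bool.≟ not (u == v))

K4-transitive : ∀ (t : Fin 4) → Σ (Wheel 0 ≅ Wheel 0) λ σ → Iso.to σ t ≡ hub 0
K4-transitive t = record { bij = σ ; pres = pres′ } , σ-t
  where
  σ : Permutation 4 4
  σ = transpose t zero
  pres′ : ∀ u v → adj (Wheel 0) (σ ⟨$⟩ʳ u) (σ ⟨$⟩ʳ v) ≡ adj (Wheel 0) u v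
  pres′ u v = trans (K4-complete (σ ⟨$⟩ʳ u) (σ ⟨$⟩ʳ v))
                    (trans (cong not (==-injective (σ ⟨$⟩ʳ_) (⟨$⟩ʳ-injective σ) u v)) (sym (K4-complete u v)))
  σ-t : σ ⟨$⟩ʳ t ≡ zero
  σ-t with t ≟ t
  ... | yes _  = refl
  ... | no t≢t = ⊥-elim (t≢t refl)

-- Separators of size less than three

at-most-one-other : (X : List (Fin k)) → length X < 3 → ∀ {h} → h ∈ₗ X →
                    ∃ λ w → w ∈ₗ X × (∀ v → v ∈ₗ X → v ≡ h ⊎ v ≡ w)
at-most-one-other (a ∷ [])     _ (here refl) = a , here refl , λ { v (here e) → inj₁ e }
at-most-one-other (a ∷ b ∷ []) _ (here refl) =
  b , there (here refl) , λ { v (here e) → inj₁ e ; v (there (here e)) → inj₂ e }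
at-most-one-other (a ∷ b ∷ []) _ (there (here refl)) =
  a , here refl , λ { v (here e) → inj₂ e ; v (there (here e)) → inj₁ e }
at-most-one-other (a ∷ b ∷ c ∷ X) (s≤s (s≤s (s≤s ())))

three-distinct-∉ : (X : List (Fin k)) → length X < 3 → ∀ {p q r} → p ≢ q → p ≢ r → q ≢ r →
                   p ∈ₗ X → q ∈ₗ X → r ∉ₗ X
three-distinct-∉ X ∣X∣<3 {p} {q} {r} p≢q p≢r q≢r p∈ q∈ r∈ with at-most-one-other X ∣X∣<3 p∈
... | w , _ , only with only q q∈ | only r r∈
...   | inj₁ q≡p | _        = p≢q (sym q≡p)
...   | _        | inj₁ r≡p = p≢r (sym r≡p)
...   | inj₂ q≡w | inj₂ r≡w = q≢r (trans q≡w (sym r≡w))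

module CyclePath {E : Fin k → Fin k → Bool} {P : Fin k → Set} (len : ℕ) (cyc : ℕ → Fin k)
  (cyc-step : ∀ s → s < len → E (cyc (suc s)) (cyc s) ≡ true) (cyc-close : E (cyc 0) (cyc len) ≡ true)
  (z : ℕ) (allowed : ∀ t → t ≤ len → t ≢ z → P (cyc t)) where

  descend : ∀ {lo} i → lo ≤ i → i ≤ len → (∀ t → lo ≤ t → t ≤ i → P (cyc t)) → Walk E P (cyc i) (cyc lo)
  descend zero    z≤n     _       ok = here (ok 0 z≤n z≤n)
  descend (suc i) lo≤1+i 1+i≤len ok with m≤n⇒m<n∨m≡n lo≤1+i
  ... | inj₂ refl   = here (ok (suc i) ≤-refl ≤-refl)
  ... | inj₁ lo<1+i = step (ok (suc i) lo≤1+i ≤-refl) (cyc-step i 1+i≤len)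
                           (descend i (≤-pred lo<1+i) (≤-trans (n≤1+n i) 1+i≤len)
                                    (λ t lo≤t t≤i → ok t lo≤t (≤-trans t≤i (n≤1+n i))))

  private
    root′ : Dec (suc z ≤ len) → ℕ
    root′ (yes _) = suc z
    root′ (no _)  = 0

  root : ℕ
  root = root′ (suc z ≤? len)

  cycle-to-root : ∀ i → i ≤ len → i ≢ z → Walk E P (cyc i) (cyc root)
  cycle-to-root i i≤len i≢z with suc z ≤? len | suc z ≤? i
  ... | yes _ | yes z<i = descend i z<i i≤len (λ t z<t t≤i → allowed t (≤-trans t≤i i≤len) (≢-sym (<⇒≢ z<t)))
  ... | yes z<len | no z≮i =
    descend i z≤n i≤len (λ t _ t≤i → allowed t (≤-trans t≤i i≤len) (<⇒≢ (≤-<-trans t≤i i<z)))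
    ++ʷ step (allowed 0 z≤n (<⇒≢ (≤-<-trans z≤n i<z))) cyc-close
             (descend len z<len ≤-refl (λ t z<t t≤len → allowed t t≤len (≢-sym (<⇒≢ z<t))))
    where
    i<z : i < z
    i<z = ≤∧≢⇒< (≮⇒≥ z≮i) i≢z
  ... | no z≮len | _ =
    descend i z≤n i≤len (λ t _ t≤i → allowed t (≤-trans t≤i i≤len) (<⇒≢ (≤-<-trans t≤i i<z)))
    where
    i<z : i < z
    i<z = ≤∧≢⇒< (≤-trans i≤len (≮⇒≥ z≮len)) i≢z

OnCycle : ∀ {A : Set} → ℕ → (ℕ → A) → A → Set
OnCycle len cyc v = ∃ λ s → s ≤ len × cyc s ≡ v

record HubCycle (E : Fin k → Fin k → Bool) (h : Fin k) : Set where
  field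
    len           : ℕ
    cyc           : ℕ → Fin k
    cyc-step      : ∀ s → s < len → E (cyc (suc s)) (cyc s) ≡ true
    cyc-close     : E (cyc 0) (cyc len) ≡ true
    cyc-injective : ∀ s s′ → s ≤ len → s′ ≤ len → cyc s ≡ cyc s′ → s ≡ s′
    cyc≢hub       : ∀ s → cyc s ≢ h
    covers        : ∀ v → v ≢ h → OnCycle len cyc v ⊎
                    (∃ λ s → ∃ λ s′ → s ≤ len × s′ ≤ len × s ≢ s′ ×
                       E v (cyc s) ≡ true × E v (cyc s′) ≡ true × ¬ OnCycle len cyc v)

  -- Besides h, X holds at most one vertex, so at most one position z of the cycle is lost: the
  -- rest of the cycle is a path, and a vertex off the cycle keeps one of its two cycle neighbours.
  connected-without-hub : (∀ u v → E u v ≡ E v u) → {Q : Fin k → Set} → (∀ w → Q w) →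
                          (X : List (Fin k)) → length X < 3 → h ∈ₗ X →
                          ∀ u v → u ∉ₗ X → v ∉ₗ X → Walk E (λ w → Q w × w ∉ₗ X) u v
  connected-without-hub E-sym {Q} all-Q X ∣X∣<3 h∈X u v u∉X v∉X =
    connected-via E-sym (cyc root) to-root u v (all-Q u , u∉X) (all-Q v , v∉X)
    where
    other : ∃ λ w → w ∈ₗ X × (∀ v → v ∈ₗ X → v ≡ h ⊎ v ≡ w)
    other = at-most-one-other X ∣X∣<3 h∈X

    w : Fin k
    w = proj₁ other

    cyc∈X⇒≡w : ∀ t → cyc t ∈ₗ X → cyc t ≡ w
    cyc∈X⇒≡w t t∈X = [ ⊥-elim ∘ cyc≢hub t , (λ e → e) ] (proj₂ (proj₂ other) (cyc t) t∈X)

    removed : ∃ λ z → ∀ t → t ≤ len → cyc t ∈ₗ X ⇔ t ≡ z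
    removed with w ≟ h
    ... | yes w≡h = suc len , λ t t≤len →
      mk⇔ (λ t∈X → ⊥-elim (cyc≢hub t (trans (cyc∈X⇒≡w t t∈X) w≡h))) (λ { refl → ⊥-elim (<-irrefl refl t≤len) })
    ... | no w≢h with covers w w≢h
    ...   | inj₁ (s , s≤len , cyc-s≡w) = s , λ t t≤len →
      mk⇔ (λ t∈X → cyc-injective t s t≤len s≤len (trans (cyc∈X⇒≡w t t∈X) (sym cyc-s≡w)))
          (λ { refl → subst (_∈ₗ X) (sym cyc-s≡w) (proj₁ (proj₂ other)) })
    ...   | inj₂ (_ , _ , _ , _ , _ , _ , _ , off) = suc len , λ t t≤len →
      mk⇔ (λ t∈X → ⊥-elim (off (t , t≤len , cyc∈X⇒≡w t t∈X))) (λ { refl → ⊥-elim (<-irrefl refl t≤len) })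

    z : ℕ
    z = proj₁ removed

    kept : ∀ t → t ≤ len → t ≢ z → cyc t ∉ₗ X
    kept t t≤len t≢z = t≢z ∘ Equivalence.to (proj₂ removed t t≤len)

    open CyclePath {E = E} {P = λ w → Q w × w ∉ₗ X} len cyc cyc-step cyc-close z
                   (λ t t≤len t≢z → all-Q (cyc t) , kept t t≤len t≢z)

    to-root : ∀ u → Q u × u ∉ₗ X → Walk E (λ w → Q w × w ∉ₗ X) u (cyc root)
    to-root u u-ok@(_ , u∉X) with covers u (λ u≡h → u∉X (subst (_∈ₗ X) (sym u≡h) h∈X))
    ... | inj₁ (s , s≤len , refl) = cycle-to-root s s≤len (u∉X ∘ Equivalence.from (proj₂ removed s s≤len))
    ... | inj₂ (s , s′ , s≤len , s′≤len , s≢s′ , us , us′ , _) with s ≟ℕ z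
    ...   | no s≢z  = step u-ok us (cycle-to-root s s≤len s≢z)
    ...   | yes s≡z = step u-ok us′ (cycle-to-root s′ s′≤len (λ s′≡z → s≢s′ (trans s≡z (sym s′≡z))))

module _ {G : Graph} (H : Subgraph G) (spanning : ∀ v → v ∈ vs H) (h : Fin (n G)) where

  hub-cycle⇒3-connected :
    3 < ∣ vs H ∣ → HubCycle (es H) h →
    (∀ X → length X < 3 → h ∉ₗ X → ∀ u → u ∉ₗ X → Walk (es H) (λ w → w ∈ vs H × w ∉ₗ X) u h) →
    ThreeConnectedSub H
  hub-cycle⇒3-connected 3<∣H∣ cycle to-hub = 3<∣H∣ , walks
    where
    walks : NoSmallSeparator H
    walks X ∣X∣<3 _ u v _ _ u∉X v∉X with Any.any? (h ≟_) X
    ... | yes h∈X = HubCycle.connected-without-hub cycle (es-sym H) spanning X ∣X∣<3 h∈X u v u∉X v∉X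
    ... | no  h∉X = connected-via (es-sym H) h (λ w (_ , w∉X) → to-hub X ∣X∣<3 h∉X w w∉X)
                                  u v (spanning u , u∉X) (spanning v , v∉X)

module _ {G : Graph} (H : Subgraph G) (3con : ThreeConnectedSub H) where

  degree≥3 : ∀ {w} → w ∈ vs H → (Y : List (Fin (n G))) → length Y < 3 →
             ¬ (∀ v → es H w v ≡ true → v ∈ₗ Y)
  degree≥3 {w} w∈ Y ∣Y∣<3 Y-covers with length<∣p∣⇒∃∉ (vs H) (w ∷ Y) (≤-trans (s≤s ∣Y∣<3) (proj₁ 3con))
  ... | v , v∈ , v∉w∷Y =
    escape (proj₂ 3con Y′ (≤-<-trans (length-filter _ Y) ∣Y∣<3) Y′⊆H w v w∈ v∈ w∉Y′
                   (v∉w∷Y ∘ there ∘ proj₁ ∘ ∈-filter⁻ _ {xs = Y}))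
           v∉w∷Y
    where
    Y′ : List (Fin (n G))
    Y′ = filter (λ u → (u SubsetProps.∈? vs H) ×-dec ¬? (u ≟ w)) Y
    Y′⊆H : All (_∈ vs H) Y′
    Y′⊆H = All.map proj₁ (all-filter _ Y)
    w∉Y′ : w ∉ₗ Y′
    w∉Y′ w∈Y′ = proj₂ (proj₂ (∈-filter⁻ _ {xs = Y} w∈Y′)) refl
    escape : ∀ {u} → Walk (es H) (λ q → q ∈ vs H × q ∉ₗ Y′) w u → u ∉ₗ w ∷ Y → ⊥
    escape (here _)               u∉ = u∉ (here refl)
    escape (step {w = w′} _ e rest) _ =
      proj₂ (source-allowed rest)
            (∈-filter⁺ _ (Y-covers w′ e) (proj₂ (ends H w w′ e) , ≢-sym (adj⇒≢ G (es⊆ H w w′ e))))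

  degree-three-keeps-edges : ∀ {w} → w ∈ vs H → (L : List (Fin (n G))) → length L ≤ 3 →
                             (∀ v → adj G w v ≡ true → v ∈ₗ L) → ∀ v → adj G w v ≡ true → es H w v ≡ true
  degree-three-keeps-edges {w} w∈ L ∣L∣≤3 L-covers v wv with es H w v in eq
  ... | true  = refl
  ... | false = ⊥-elim (degree≥3 w∈ (filter (λ u → ¬? (u ≟ v)) L)
                          (<-≤-trans (filter-notAll _ L (Any.map (λ v≡u u≢v → u≢v (sym v≡u)) (L-covers v wv))) ∣L∣≤3)
                          (λ u e → ∈-filter⁺ _ (L-covers u (es⊆ H w u e)) λ { refl → true≢false e eq }))

-- Wheels are super-minimally 3-connected

3<∣⊤∣ : ∀ k → 3 < ∣ ⊤ {4 + k} ∣
3<∣⊤∣ k = subst (3 <_) (sym (∣⊤∣≡n (4 + k))) (s≤s (s≤s (s≤s (s≤s z≤n))))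

module WheelSuperMinimal (m : ℕ) where
  open WheelRim m

  rim-cycle : HubCycle (adj (Wheel m)) (hub m)
  rim-cycle = record
    { len           = 2 + m
    ; cyc           = λ s → suc (next^ s zero)
    ; cyc-step      = λ s _ → rim-adj⁺ (next (next^ s zero)) (next^ s zero) (inj₂ refl)
    ; cyc-close     = rim-adj⁺ zero (next^ (2 + m) zero) (inj₂ (sym (next^-wrap zero)))
    ; cyc-injective = λ s s′ s≤ s′≤ → next^-zero-injective s s′ s≤ s′≤ ∘ suc-injective
    ; cyc≢hub       = λ _ ()
    ; covers        = λ where
        zero    hub≢hub → ⊥-elim (hub≢hub refl)
        (suc i) _       → inj₁ (toℕ i , ≤-pred (toℕ<n i) , cong suc (next^-zero i))
    }

  wheel-3-connected : ThreeConnected (Wheel m)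
  wheel-3-connected = hub-cycle⇒3-connected (whole (Wheel m)) (λ _ → ∈⊤) (hub m) (3<∣⊤∣ m) rim-cycle
    λ X _ hub∉X → λ where
      zero    _   → here (∈⊤ , hub∉X)
      (suc i) i∉X → edgeʷ (∈⊤ , i∉X) (∈⊤ , hub∉X) refl

  module _ (H : Subgraph (Wheel m)) (3con : ThreeConnectedSub H) where

    rim-edges-kept : ∀ i → suc i ∈ vs H → ∀ v → adj (Wheel m) (suc i) v ≡ true → es H (suc i) v ≡ true
    rim-edges-kept i i∈ =
      degree-three-keeps-edges H 3con i∈ (zero ∷ suc (next i) ∷ suc (prev i) ∷ []) ≤-refl (rim-neighbours i)

    next-kept : ∀ i → suc i ∈ vs H → suc (next i) ∈ vs H
    next-kept i i∈ = proj₂ (ends H _ _ (rim-edges-kept i i∈ (suc (next i)) (rim-adj⁺ i (next i) (inj₁ refl))))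

    next^-kept : ∀ i → suc i ∈ vs H → ∀ j → suc (next^ j i) ∈ vs H
    next^-kept i i∈ zero    = i∈
    next^-kept i i∈ (suc j) = next-kept (next^ j i) (next^-kept i i∈ j)

    all-kept : ∀ i → suc i ∈ vs H → ∀ v → v ∈ vs H
    all-kept i i∈ zero    = proj₂ (ends H _ _ (rim-edges-kept i i∈ zero refl))
    all-kept i i∈ (suc r) = subst (λ q → suc q ∈ vs H) (next^-reaches i r) (next^-kept i i∈ (toℕ r + suc (2 + m ∸ toℕ i)))

  wheel-minimal : ∀ (H : Subgraph (Wheel m)) → Proper H → ¬ ThreeConnectedSub H
  wheel-minimal H H-proper 3con with length<∣p∣⇒∃∉ (vs H) (hub m ∷ []) (≤-trans (s≤s (s≤s z≤n)) (proj₁ 3con))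
  ... | zero  , _  , hub∉ = hub∉ (here refl)
  ... | suc i , i∈ , _    = missing H-proper
    where
    missing : Proper H → ⊥
    missing (inj₁ (v , v∉)) = v∉ (all-kept H 3con i i∈ v)
    missing (inj₂ (zero , suc j , _ , e)) =
      true≢false (rim-edges-kept H 3con j (all-kept H 3con i i∈ (suc j)) zero refl) (trans (es-sym H (suc j) zero) e)
    missing (inj₂ (suc j , v , a , e)) =
      true≢false (rim-edges-kept H 3con j (all-kept H 3con i i∈ (suc j)) v a) e

  wheel-superMinimal : SuperMinimal3Connected (Wheel m)
  wheel-superMinimal = wheel-3-connected , wheel-minimal

-- Bridging the hub to a rim edge

cycRel-true⇔ : ∀ {k} (i j : Fin k) → cycRel k i j ≡ true ⇔ (toℕ j ≡ suc (toℕ i) ⊎ (toℕ i ≡ 0 × suc (toℕ j) ≡ k))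
cycRel-true⇔ {k} i j = mk⇔ to from
  where
  to : cycRel k i j ≡ true → toℕ j ≡ suc (toℕ i) ⊎ (toℕ i ≡ 0 × suc (toℕ j) ≡ k)
  to e with ∨-true⁻ {suc (toℕ i) ≡ᵇ toℕ j} e
  ... | inj₁ forward = inj₁ (sym (≡ᵇ-true⁻ forward))
  ... | inj₂ wrap    = inj₂ (≡ᵇ-true⁻ (∧-trueˡ wrap) , ≡ᵇ-true⁻ (∧-trueʳ {toℕ i ≡ᵇ 0} wrap))
  from : toℕ j ≡ suc (toℕ i) ⊎ (toℕ i ≡ 0 × suc (toℕ j) ≡ k) → cycRel k i j ≡ true
  from (inj₁ e)           = ∨-trueˡ _ (≡ᵇ-true⁺ (sym e))
  from (inj₂ (i≡0 , j≡k)) = ∨-trueʳ (suc (toℕ i) ≡ᵇ toℕ j) (∧-true (≡ᵇ-true⁺ i≡0) (≡ᵇ-true⁺ j≡k))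

Consecutive : Fin k → Fin k → Set
Consecutive i j = toℕ j ≡ suc (toℕ i) ⊎ toℕ i ≡ suc (toℕ j)

module HubBridge (m : ℕ) where
  open WheelRim m

  module _ (a : Fin (3 + m)) (next-a≡0 : next a ≡ zero) where

    toℕ-a : toℕ a ≡ 2 + m
    toℕ-a = toℕ-next≡zero a next-a≡0

    r : Fin (5 + m) → Fin (5 + m) → Bool
    r = bridgeRel (Wheel m) (hub m) (suc a) (suc zero)

    new-first⇔ : ∀ t → symmetrise (cycRel (4 + m)) zero (suc t) ≡ true ⇔ (t ≡ a ⊎ t ≡ zero)
    new-first⇔ t = mk⇔ to from
      where
      to : symmetrise (cycRel (4 + m)) zero (suc t) ≡ true → t ≡ a ⊎ t ≡ zero
      to e with ∨-true⁻ {cycRel (4 + m) zero (suc t)} e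
      ... | inj₂ e′ with Equivalence.to (cycRel-true⇔ (suc t) zero) e′
      ...   | inj₁ ()
      ...   | inj₂ (() , _)
      to e | inj₁ e′ with Equivalence.to (cycRel-true⇔ zero (suc t)) e′
      ...   | inj₁ t+1≡1       = inj₂ (toℕ-injective (suc-injectiveℕ t+1≡1))
      ...   | inj₂ (_ , t+2≡k) = inj₁ (toℕ-injective (trans (suc-injectiveℕ (suc-injectiveℕ t+2≡k)) (sym toℕ-a)))
      from : t ≡ a ⊎ t ≡ zero → symmetrise (cycRel (4 + m)) zero (suc t) ≡ true
      from (inj₁ refl) = ∨-trueˡ (cycRel (4 + m) (suc t) zero)
        (Equivalence.from (cycRel-true⇔ zero (suc t)) (inj₂ (refl , cong (λ i → suc (suc i)) toℕ-a)))
      from (inj₂ refl) = ∨-trueˡ (cycRel (4 + m) (suc t) zero) (Equivalence.from (cycRel-true⇔ zero (suc t)) (inj₁ refl))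

    subdivision⇔ : ∀ t → symmetrise r zero (suc (suc t)) ≡ true ⇔ (t ≡ a ⊎ t ≡ zero)
    subdivision⇔ t = mk⇔ to from
      where
      to : symmetrise r zero (suc (suc t)) ≡ true → t ≡ a ⊎ t ≡ zero
      to e with ∨-true⁻ {suc t == suc a} (∨-trueˡ⁻ e)
      ... | inj₁ t≡a = inj₁ (suc-injective (==⇒≡ t≡a))
      ... | inj₂ e′ with ∨-true⁻ {suc t == suc zero} e′
      ...   | inj₁ t≡0 = inj₂ (suc-injective (==⇒≡ t≡0))
      from : t ≡ a ⊎ t ≡ zero → symmetrise r zero (suc (suc t)) ≡ true
      from (inj₁ refl) = ∨-trueˡ false (∨-trueˡ ((suc a == suc zero) ∨ false) (==-refl (suc a)))
      from (inj₂ refl) = ∨-trueˡ false (∨-trueʳ (suc zero == suc a) (∨-trueˡ false (==-refl {4 + m} (suc zero))))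

    new-rim⇔ : ∀ s t → cycRel (4 + m) (suc s) (suc t) ≡ true ⇔ toℕ t ≡ suc (toℕ s)
    new-rim⇔ s t = mk⇔
      ([ suc-injectiveℕ , (λ { (() , _) }) ] ∘ Equivalence.to (cycRel-true⇔ (suc s) (suc t)))
      (Equivalence.from (cycRel-true⇔ (suc s) (suc t)) ∘ inj₁ ∘ cong suc)

    old-rim⁻ : ∀ s t → r (suc (suc s)) (suc (suc t)) ≡ true → Consecutive s t
    old-rim⁻ s t e with rim-adj⁻ s t (∧-trueˡ e) | next-spec s | next-spec t
    ... | inj₁ t≡next-s | inj₁ (_ , e′) | _ = inj₁ (trans (cong toℕ t≡next-s) e′)
    ... | inj₁ t≡next-s | inj₂ (s≡K , next-s≡0) | _ =
      ⊥-elim (true≢false (∨-trueˡ _ (∧-true (≡⇒== (cong suc (toℕ-injective (trans s≡K (sym toℕ-a)))))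
                                             (≡⇒== (cong suc (trans t≡next-s next-s≡0)))))
                         (not-true⁻ (∧-trueʳ e)))
    ... | inj₂ s≡next-t | _ | inj₁ (_ , e′) = inj₂ (trans (cong toℕ s≡next-t) e′)
    ... | inj₂ s≡next-t | _ | inj₂ (t≡K , next-t≡0) =
      ⊥-elim (true≢false (∨-trueʳ ((suc s == suc a) ∧ (suc t == suc zero)) (∧-true (≡⇒== (cong suc (trans s≡next-t next-t≡0)))
                                             (≡⇒== (cong suc (toℕ-injective (trans t≡K (sym toℕ-a)))))))
                         (not-true⁻ (∧-trueʳ e)))

    old-rim⁺ : ∀ s t → toℕ t ≡ suc (toℕ s) → r (suc (suc s)) (suc (suc t)) ≡ true
    old-rim⁺ s t t≡1+s = ∧-true (rim-adj⁺ s t (inj₁ t≡next-s)) (not-false (∨-false not-a0 not-0a))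
      where
      t≡next-s : t ≡ next s
      t≡next-s with next-spec s
      ... | inj₁ (_ , e)   = toℕ-injective (trans t≡1+s (sym e))
      ... | inj₂ (s≡K , _) = ⊥-elim (<-irrefl refl (subst (_< 3 + m) (trans t≡1+s (cong suc s≡K)) (toℕ<n t)))
      not-a0 : ((suc s == suc a) ∧ (suc t == suc zero)) ≢ true
      not-a0 q = case trans (sym t≡1+s) (cong toℕ (suc-injective (==⇒≡ (∧-trueʳ q)))) of λ ()
      not-0a : ((suc s == suc zero) ∧ (suc t == suc a)) ≢ true
      not-0a q = case trans (sym (trans t≡1+s (cong (suc ∘ toℕ) (suc-injective (==⇒≡ (∧-trueˡ q))))))
                            (trans (cong toℕ (suc-injective (==⇒≡ (∧-trueʳ q)))) toℕ-a) of λ ()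

    old-rim⇔ : ∀ s t → symmetrise r (suc (suc s)) (suc (suc t)) ≡ true ⇔ Consecutive s t
    old-rim⇔ s t = mk⇔
      ([ old-rim⁻ s t , [ inj₂ , inj₁ ] ∘ old-rim⁻ t s ] ∘ ∨-true⁻)
      [ ∨-trueˡ _ ∘ old-rim⁺ s t , ∨-trueʳ _ ∘ old-rim⁺ t s ]

    -- Swapping y and the hub makes y rim vertex 0 of the bigger wheel and old rim vertex r its r + 1.
    bridge-hub-last-first≅ : bridge (Wheel m) (hub m) (suc a) (suc zero) ≅ Wheel (suc m)
    bridge-hub-last-first≅ = fromRel-≅ r (wheelRel (suc m)) (transpose zero (suc zero)) same
      where
      new-rim-sym⇔ : ∀ s t → symmetrise (cycRel (4 + m)) (suc s) (suc t) ≡ true ⇔ Consecutive s t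
      new-rim-sym⇔ s t = mk⇔
        ([ inj₁ ∘ Equivalence.to (new-rim⇔ s t) , inj₂ ∘ Equivalence.to (new-rim⇔ t s) ] ∘ ∨-true⁻)
        [ ∨-trueˡ (cycRel (4 + m) (suc t) (suc s)) ∘ Equivalence.from (new-rim⇔ s t)
        , ∨-trueʳ (cycRel (4 + m) (suc s) (suc t)) ∘ Equivalence.from (new-rim⇔ t s) ]
      sw : Fin (5 + m) → Fin (5 + m)
      sw = transpose zero (suc zero) ⟨$⟩ʳ_
      swapped : ∀ {u v} → symmetrise (wheelRel (suc m)) (sw u) (sw v) ≡ symmetrise r u v →
                symmetrise (wheelRel (suc m)) (sw v) (sw u) ≡ symmetrise r v u
      swapped {u} {v} e = trans (∨-comm (wheelRel (suc m) (sw v) (sw u)) (wheelRel (suc m) (sw u) (sw v)))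
                                (trans e (∨-comm (r u v) (r v u)))
      y-rim : ∀ t → symmetrise (wheelRel (suc m)) (sw zero) (sw (suc (suc t))) ≡ symmetrise r zero (suc (suc t))
      y-rim t = ⇔→≡ (⇔-sym (subdivision⇔ t) ⇔-∘ new-first⇔ t)
      hub-rim : ∀ t → symmetrise (wheelRel (suc m)) (sw (suc zero)) (sw (suc (suc t))) ≡ symmetrise r (suc zero) (suc (suc t))
      hub-rim t = refl
      same : ∀ u v → u ≢ v → symmetrise (wheelRel (suc m)) (sw u) (sw v) ≡ symmetrise r u v
      same zero          zero          0≢0 = ⊥-elim (0≢0 refl)
      same zero          (suc zero)    _   = refl
      same zero          (suc (suc t)) _   = y-rim t
      same (suc zero)    zero          _   = refl
      same (suc zero)    (suc zero)    1≢1 = ⊥-elim (1≢1 refl)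
      same (suc zero)    (suc (suc t)) _   = hub-rim t
      same (suc (suc s)) zero          _   = swapped {zero} {suc (suc s)} (y-rim s)
      same (suc (suc s)) (suc zero)    _   = swapped {suc zero} {suc (suc s)} (hub-rim s)
      same (suc (suc s)) (suc (suc t)) _   = ⇔→≡ (⇔-sym (old-rim⇔ s t) ⇔-∘ new-rim-sym⇔ s t)

  bridge-hub-next≅ : ∀ i → bridge (Wheel m) (hub m) (suc i) (suc (next i)) ≅ Wheel (suc m)
  bridge-hub-next≅ i = ≅-trans (bridge-rotate-rim-edge i refl) (bridge-hub-last-first≅ _ (rotated-next≡0 i))

  bridge-hub-rim≅ : ∀ i j → RimAdj i j → bridge (Wheel m) (hub m) (suc i) (suc j) ≅ Wheel (suc m)
  bridge-hub-rim≅ i _ (inj₁ refl) = bridge-hub-next≅ i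
  bridge-hub-rim≅ _ j (inj₂ refl) = ≅-trans (bridge-comm (Wheel m) (hub m) (suc (next j)) (suc j)) (bridge-hub-next≅ j)

-- Bridging from a rim vertex

edgeIs : Fin k → Fin k → Fin k → Fin k → Bool
edgeIs p q u v = ((u == p) ∧ (v == q)) ∨ ((u == q) ∧ (v == p))

edgeIs-false : ∀ {p q u v : Fin k} → ¬ (u ≡ p × v ≡ q) → ¬ (u ≡ q × v ≡ p) → edgeIs p q u v ≡ false
edgeIs-false {p = p} {q} {u} {v} ≢pq ≢qp = ∨-false
  (λ e → ≢pq (==⇒≡ (∧-trueˡ e) , ==⇒≡ (∧-trueʳ {u == p} e)))
  (λ e → ≢qp (==⇒≡ (∧-trueˡ e) , ==⇒≡ (∧-trueʳ {u == q} e)))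

edgeIs-sym : ∀ (p q u v : Fin k) → edgeIs p q u v ≡ edgeIs p q v u
edgeIs-sym p q u v = trans (∨-comm ((u == p) ∧ (v == q)) ((u == q) ∧ (v == p)))
                           (cong₂ _∨_ (∧-comm (u == q) (v == p)) (∧-comm (u == p) (v == q)))

deleteEdge : (G : Graph) → Fin (n G) → Fin (n G) → Subgraph G
deleteEdge G p q = record
  { vs     = ⊤
  ; es     = λ u v → adj G u v ∧ not (edgeIs p q u v)
  ; es-sym = λ u v → cong₂ (λ e d → e ∧ not d) (Graph.sym G u v) (edgeIs-sym p q u v)
  ; es⊆    = λ _ _ → ∧-trueˡ
  ; ends   = λ _ _ _ → ∈⊤ , ∈⊤
  }

deleteEdge-proper : ∀ (G : Graph) {p q} → adj G p q ≡ true → Proper (deleteEdge G p q)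
deleteEdge-proper G {p} {q} pq = inj₂ (p , q , pq , cong₂ (λ e d → e ∧ not d) pq edgeIs-pq)
  where
  edgeIs-pq : edgeIs p q p q ≡ true
  edgeIs-pq = ∨-trueˡ _ (∧-true (==-refl p) (==-refl q))

deleteEdge-es⁺ : ∀ (G : Graph) p q {u v} → adj G u v ≡ true → ¬ (u ≡ p × v ≡ q) → ¬ (u ≡ q × v ≡ p) →
                 es (deleteEdge G p q) u v ≡ true
deleteEdge-es⁺ G p q uv ≢pq ≢qp = ∧-true uv (not-false (edgeIs-false ≢pq ≢qp))

bridge-adj-new : ∀ (G : Graph) (x a b : Fin (n G)) {v} → v ≡ a ⊎ v ≡ b ⊎ v ≡ x →
                 adj (bridge G x a b) zero (suc v) ≡ true
bridge-adj-new G x a b {v} v∈ = fromRel-adj⁺ (bridgeRel G x a b) {zero} {suc v} (λ ()) (inj₁ (new v∈))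
  where
  new : v ≡ a ⊎ v ≡ b ⊎ v ≡ x → ((v == a) ∨ (v == b) ∨ (v == x)) ≡ true
  new (inj₁ refl)        = ∨-trueˡ _ (==-refl v)
  new (inj₂ (inj₁ refl)) = ∨-trueʳ (v == a) (∨-trueˡ _ (==-refl v))
  new (inj₂ (inj₂ refl)) = ∨-trueʳ (v == a) (∨-trueʳ (v == b) (==-refl v))

bridge-adj-old : ∀ (G : Graph) (x a b : Fin (n G)) {u v} → adj G u v ≡ true →
                 ¬ (u ≡ a × v ≡ b) → ¬ (u ≡ b × v ≡ a) → adj (bridge G x a b) (suc u) (suc v) ≡ true
bridge-adj-old G x a b uv ≢ab ≢ba =
  fromRel-adj⁺ (bridgeRel G x a b) (adj⇒≢ G uv ∘ suc-injective)
               (inj₁ (∧-true uv (not-false (edgeIs-false ≢ab ≢ba))))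

module SpokeDeletion (m : ℕ) (t : Fin (3 + m)) (a b : Fin (4 + m)) where

  B : Graph
  B = bridge (Wheel m) (suc t) a b

  y h : Fin (n B)
  y = zero
  h = suc zero

  rim : Fin (3 + m) → Fin (n B)
  rim r = suc (suc r)

  rim-injective : Injective _≡_ _≡_ rim
  rim-injective = suc-injective ∘ suc-injective

  rim≢ : ∀ {r r′} → r ≢ r′ → rim r ≢ rim r′
  rim≢ r≢r′ = r≢r′ ∘ rim-injective

  rim≢y : ∀ {r} → rim r ≢ y
  rim≢y ()

  H : Subgraph B
  H = deleteEdge B h (rim t)

  E : Fin (n B) → Fin (n B) → Bool
  E = es H

  E-y : ∀ {v} → v ≡ a ⊎ v ≡ b ⊎ v ≡ suc t → E y (suc v) ≡ true
  E-y {v} v∈ = deleteEdge-es⁺ B h (rim t) {y} {suc v} (bridge-adj-new (Wheel m) (suc t) a b v∈)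
                              (λ { (() , _) }) (λ { (() , _) })

  E-old : ∀ {u v} → adj (Wheel m) u v ≡ true → ¬ (u ≡ a × v ≡ b) → ¬ (u ≡ b × v ≡ a) →
          ¬ (u ≡ zero × v ≡ suc t) → ¬ (u ≡ suc t × v ≡ zero) → E (suc u) (suc v) ≡ true
  E-old {u} {v} uv ≢ab ≢ba ≢h-t ≢t-h = deleteEdge-es⁺ B h (rim t) {suc u} {suc v}
    (bridge-adj-old (Wheel m) (suc t) a b uv ≢ab ≢ba)
    (λ (e₁ , e₂) → ≢h-t (suc-injective e₁ , suc-injective e₂))
    (λ (e₁ , e₂) → ≢t-h (suc-injective e₁ , suc-injective e₂))

  deletable-spoke⇒¬superMinimal :
    ¬ (zero ≡ a × suc t ≡ b) → ¬ (zero ≡ b × suc t ≡ a) → HubCycle E h →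
    (∀ X → length X < 3 → h ∉ₗ X → ∀ u → u ∉ₗ X → Walk E (λ w → w ∈ ⊤ × w ∉ₗ X) u h) →
    ¬ SuperMinimal3Connected B
  deletable-spoke⇒¬superMinimal ≢ab ≢ba cycle to-hub (_ , minimal) =
    minimal H (deleteEdge-proper B (bridge-adj-old (Wheel m) (suc t) a b {zero} {suc t} refl ≢ab ≢ba))
            (hub-cycle⇒3-connected H (λ _ → ∈⊤) h (3<∣⊤∣ (suc m)) cycle to-hub)

module RimBridgeRimEdge (m : ℕ) (3≤K : 3 ≤ 2 + m) where
  open WheelRim m

  module _ (a t : Fin (3 + m)) (next-a≡0 : next a ≡ zero) (t≢a : t ≢ a) (t≢0 : t ≢ zero) where
    open SpokeDeletion m t (suc a) (suc zero)

    E-rim-hub : ∀ r → r ≢ t → E (rim r) h ≡ true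
    E-rim-hub r r≢t = E-old {suc r} {zero} refl (λ { (_ , ()) }) (λ { (_ , ()) }) (λ { (() , _) })
                            (λ (e , _) → r≢t (suc-injective e))

    E-rim-rim : ∀ r r′ → RimAdj r r′ → ¬ (r ≡ a × r′ ≡ zero) → ¬ (r ≡ zero × r′ ≡ a) → E (rim r) (rim r′) ≡ true
    E-rim-rim r r′ rr′ ≢a0 ≢0a = E-old {suc r} {suc r′} (rim-adj⁺ r r′ rr′)
      (λ (e₁ , e₂) → ≢a0 (suc-injective e₁ , suc-injective e₂))
      (λ (e₁ , e₂) → ≢0a (suc-injective e₁ , suc-injective e₂))
      (λ { (() , _) }) (λ { (_ , ()) })

    toℕ-a : toℕ a ≡ 2 + m
    toℕ-a = toℕ-next≡zero a next-a≡0

    cycle : HubCycle E h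
    cycle = record
      { len           = 3 + m
      ; cyc           = cyc
      ; cyc-step      = cyc-step
      ; cyc-close     = E-y {suc (next^ (2 + m) zero)} (inj₁ (cong suc (next-injective (trans (next^-wrap zero) (sym next-a≡0)))))
      ; cyc-injective = cyc-injective
      ; cyc≢hub       = λ { zero () ; (suc _) () }
      ; covers        = λ where
          zero          _   → inj₁ (0 , z≤n , refl)
          (suc zero)    h≢h → ⊥-elim (h≢h refl)
          (suc (suc r)) _   → inj₁ (suc (toℕ r) , s≤s (≤-pred (toℕ<n r)) , cong rim (next^-zero r))
      }
      where
      cyc : ℕ → Fin (n B)
      cyc zero    = y
      cyc (suc s) = rim (next^ s zero)

      cyc-step : ∀ s → s < 3 + m → E (cyc (suc s)) (cyc s) ≡ true
      cyc-step zero    _          = trans (es-sym H (rim zero) y) (E-y (inj₂ (inj₁ refl)))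
      cyc-step (suc s) (s≤s s<K) = E-rim-rim (next (next^ s zero)) (next^ s zero) (inj₂ refl) not-a0 not-0a
        where
        not-a0 : ¬ (next (next^ s zero) ≡ a × next^ s zero ≡ zero)
        not-a0 (e₁ , e₂) = case trans (sym (toℕ-next^-zero 1 (s≤s z≤n)))
                                      (trans (cong (toℕ ∘ next) (sym e₂)) (trans (cong toℕ e₁) toℕ-a)) of λ ()
        not-0a : ¬ (next (next^ s zero) ≡ zero × next^ s zero ≡ a)
        not-0a (_ , e₂) = <-irrefl (trans (sym (toℕ-next^-zero s (<⇒≤ s<K))) (trans (cong toℕ e₂) toℕ-a)) s<K

      cyc-injective : ∀ s s′ → s ≤ 3 + m → s′ ≤ 3 + m → cyc s ≡ cyc s′ → s ≡ s′
      cyc-injective zero    zero     _         _          _ = refl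
      cyc-injective (suc s) (suc s′) (s≤s s≤K) (s≤s s′≤K) e =
        cong suc (next^-zero-injective s s′ s≤K s′≤K (rim-injective e))

    module HubKept (X : List (Fin (n B))) (∣X∣<3 : length X < 3) (h∉X : h ∉ₗ X) where
      open import Data.List.Membership.DecPropositional (_≟_ {n B}) using (_∈?_)

      Ok : Fin (n B) → Set
      Ok w = w ∈ ⊤ × w ∉ₗ X

      via : ∀ r → r ≢ t → rim r ∉ₗ X → Walk E Ok (rim r) h
      via r r≢t r∉X = edgeʷ (∈⊤ , r∉X) (∈⊤ , h∉X) (E-rim-hub r r≢t)

      E-t-prev : E (rim t) (rim (prev t)) ≡ true
      E-t-prev = E-rim-rim t (prev t) (inj₂ (sym (next∘prev t))) (t≢a ∘ proj₁) (t≢0 ∘ proj₁)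

      E-t-next : E (rim t) (rim (next t)) ≡ true
      E-t-next = E-rim-rim t (next t) (inj₁ refl) (t≢a ∘ proj₁) (t≢0 ∘ proj₁)

      E-t-y : E (rim t) y ≡ true
      E-t-y = trans (es-sym H (rim t) y) (E-y (inj₂ (inj₂ refl)))

      a≢0 : a ≢ zero
      a≢0 a≡0 = next≢id zero (subst (λ z → next z ≡ zero) a≡0 next-a≡0)

      -- a, 0, prev t and next t contain three distinct vertices, which cannot all lie in X.
      not-all-four : rim a ∈ₗ X → rim zero ∈ₗ X → rim (prev t) ∈ₗ X → rim (next t) ∈ₗ X → ⊥
      not-all-four a∈ 0∈ p∈ q∈ with prev t ≟ zero
      ... | no  p≢0 = three-distinct-∉ X ∣X∣<3 (rim≢ a≢0) (rim≢ a≢p) (rim≢ (≢-sym p≢0)) a∈ 0∈ p∈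
        where
        a≢p : a ≢ prev t
        a≢p a≡p = t≢0 (trans (sym (next∘prev t)) (trans (cong next (sym a≡p)) next-a≡0))
      ... | yes p≡0 = three-distinct-∉ X ∣X∣<3 (rim≢ a≢0) (rim≢ a≢q) (rim≢ 0≢q) a∈ 0∈ q∈
        where
        t≡1 : t ≡ next zero
        t≡1 = trans (sym (next∘prev t)) (cong next p≡0)
        a≢q : a ≢ next t
        a≢q a≡q = next³≢id 3≤K zero (trans (cong (next ∘ next) (sym t≡1)) (trans (cong next (sym a≡q)) next-a≡0))
        0≢q : zero ≢ next t
        0≢q 0≡q = t≢a (next-injective (trans (sym 0≡q) (sym next-a≡0)))

      neighbours∈X⇒y∉X : rim (prev t) ∈ₗ X → rim (next t) ∈ₗ X → y ∉ₗ X
      neighbours∈X⇒y∉X = three-distinct-∉ X ∣X∣<3 (rim≢ (prev≢next t)) rim≢y rim≢y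

      ends∈X⇒t∉X : rim a ∈ₗ X → rim zero ∈ₗ X → rim t ∉ₗ X
      ends∈X⇒t∉X = three-distinct-∉ X ∣X∣<3 (rim≢ a≢0) (rim≢ (≢-sym t≢a)) (rim≢ (≢-sym t≢0))

      from-t : rim t ∉ₗ X → Walk E Ok (rim t) h
      from-t t∉X with rim (prev t) ∈? X | rim (next t) ∈? X
      ... | no p∉X | _      = step (∈⊤ , t∉X) E-t-prev (via (prev t) (prev≢id t) p∉X)
      ... | yes _  | no q∉X = step (∈⊤ , t∉X) E-t-next (via (next t) (next≢id t) q∉X)
      ... | yes p∈ | yes q∈ with rim a ∈? X | rim zero ∈? X
      ...   | no a∉X | _      =
        step (∈⊤ , t∉X) E-t-y (step (∈⊤ , neighbours∈X⇒y∉X p∈ q∈) (E-y (inj₁ refl)) (via a (≢-sym t≢a) a∉X))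
      ...   | yes _  | no 0∉X =
        step (∈⊤ , t∉X) E-t-y (step (∈⊤ , neighbours∈X⇒y∉X p∈ q∈) (E-y (inj₂ (inj₁ refl))) (via zero (≢-sym t≢0) 0∉X))
      ...   | yes a∈ | yes 0∈ = ⊥-elim (not-all-four a∈ 0∈ p∈ q∈)

      from-y : y ∉ₗ X → Walk E Ok y h
      from-y y∉X with rim a ∈? X | rim zero ∈? X
      ... | no a∉X | _      = step (∈⊤ , y∉X) (E-y (inj₁ refl)) (via a (≢-sym t≢a) a∉X)
      ... | yes _  | no 0∉X = step (∈⊤ , y∉X) (E-y (inj₂ (inj₁ refl))) (via zero (≢-sym t≢0) 0∉X)
      ... | yes a∈ | yes 0∈ with rim (prev t) ∈? X | rim (next t) ∈? X
      ...   | no p∉X | _      =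
        step (∈⊤ , y∉X) (E-y (inj₂ (inj₂ refl))) (step (∈⊤ , ends∈X⇒t∉X a∈ 0∈) E-t-prev (via (prev t) (prev≢id t) p∉X))
      ...   | yes _  | no q∉X =
        step (∈⊤ , y∉X) (E-y (inj₂ (inj₂ refl))) (step (∈⊤ , ends∈X⇒t∉X a∈ 0∈) E-t-next (via (next t) (next≢id t) q∉X))
      ...   | yes p∈ | yes q∈ = ⊥-elim (not-all-four a∈ 0∈ p∈ q∈)

      to-hub : ∀ u → u ∉ₗ X → Walk E Ok u h
      to-hub zero          y∉X = from-y y∉X
      to-hub (suc zero)    _   = here (∈⊤ , h∉X)
      to-hub (suc (suc r)) r∉X with r ≟ t
      ... | yes refl = from-t r∉X
      ... | no  r≢t  = via r r≢t r∉X

    not-superMinimal : ¬ SuperMinimal3Connected B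
    not-superMinimal = deletable-spoke⇒¬superMinimal (λ { (() , _) }) (λ { (() , _) }) cycle HubKept.to-hub

module RimBridgeSpoke (m : ℕ) (3≤K : 3 ≤ 2 + m) where
  open WheelRim m

  module _ (s t : Fin (3 + m)) (s≢t : s ≢ t) where
    open SpokeDeletion m t zero (suc s)

    E-rim-hub : ∀ r → r ≢ t → r ≢ s → E (rim r) h ≡ true
    E-rim-hub r r≢t r≢s = E-old {suc r} {zero} refl (λ { (() , _) }) (λ (e , _) → r≢s (suc-injective e))
                                (λ { (() , _) }) (λ (e , _) → r≢t (suc-injective e))

    E-rim-rim : ∀ r r′ → RimAdj r r′ → E (rim r) (rim r′) ≡ true
    E-rim-rim r r′ rr′ =
      E-old {suc r} {suc r′} (rim-adj⁺ r r′ rr′) (λ { (() , _) }) (λ { (_ , ()) }) (λ { (() , _) }) (λ { (_ , ()) })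

    cycle : HubCycle E h
    cycle = record
      { len           = 2 + m
      ; cyc           = cyc
      ; cyc-step      = λ j _ → E-rim-rim (next (next^ j zero)) (next^ j zero) (inj₂ refl)
      ; cyc-close     = E-rim-rim zero (next^ (2 + m) zero) (inj₂ (sym (next^-wrap zero)))
      ; cyc-injective = λ j j′ j≤K j′≤K → next^-zero-injective j j′ j≤K j′≤K ∘ rim-injective
      ; cyc≢hub       = λ _ ()
      ; covers        = λ where
          zero          _   → inj₂ (toℕ s , toℕ t , ≤-pred (toℕ<n s) , ≤-pred (toℕ<n t) , s≢t ∘ toℕ-injective
                                   , subst (λ r → E y (rim r) ≡ true) (sym (next^-zero s)) (E-y (inj₂ (inj₁ refl)))
                                   , subst (λ r → E y (rim r) ≡ true) (sym (next^-zero t)) (E-y (inj₂ (inj₂ refl)))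
                                   , λ { (_ , _ , ()) })
          (suc zero)    h≢h → ⊥-elim (h≢h refl)
          (suc (suc r)) _   → inj₁ (toℕ r , ≤-pred (toℕ<n r) , cong rim (next^-zero r))
      }
      where
      cyc : ℕ → Fin (n B)
      cyc j = rim (next^ j zero)

    module HubKept (X : List (Fin (n B))) (∣X∣<3 : length X < 3) (h∉X : h ∉ₗ X) where
      open import Data.List.Membership.DecPropositional (_≟_ {n B}) using (_∈?_)

      Ok : Fin (n B) → Set
      Ok w = w ∈ ⊤ × w ∉ₗ X

      E-y-h : E y h ≡ true
      E-y-h = E-y (inj₁ refl)

      E-prev : ∀ r → E (rim r) (rim (prev r)) ≡ true
      E-prev r = E-rim-rim r (prev r) (inj₂ (sym (next∘prev r)))

      E-next : ∀ r → E (rim r) (rim (next r)) ≡ true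
      E-next r = E-rim-rim r (next r) (inj₁ refl)

      y∈X⇒one-rim∈X : y ∈ₗ X → ∀ {r r′} → r ≢ r′ → rim r ∈ₗ X → rim r′ ∉ₗ X
      y∈X⇒one-rim∈X y∈X r≢r′ = three-distinct-∉ X ∣X∣<3 (≢-sym rim≢y) (≢-sym rim≢y) (rim≢ r≢r′) y∈X

      -- w and o are s and t in either order, the two rim vertices without a spoke in H.
      from-spokeless : ∀ w o → E (rim w) y ≡ true → (∀ r → r ≢ w → r ≢ o → E (rim r) h ≡ true) →
                       rim w ∉ₗ X → Walk E Ok (rim w) h
      from-spokeless w o E-w-y E-r-h w∉X with y ∈? X
      ... | no y∉X = step (∈⊤ , w∉X) E-w-y (edgeʷ (∈⊤ , y∉X) (∈⊤ , h∉X) E-y-h)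
      ... | yes y∈X with prev w ≟ o | next w ≟ o | rim (prev w) ∈? X | rim (next w) ∈? X
      ...   | no p≢o | _ | no p∉X | _ =
        step (∈⊤ , w∉X) (E-prev w) (edgeʷ (∈⊤ , p∉X) (∈⊤ , h∉X) (E-r-h (prev w) (prev≢id w) p≢o))
      ...   | no _ | no q≢o | yes _ | no q∉X =
        step (∈⊤ , w∉X) (E-next w) (edgeʷ (∈⊤ , q∉X) (∈⊤ , h∉X) (E-r-h (next w) (next≢id w) q≢o))
      ...   | no _ | yes q≡o | yes p∈X | no q∉X =
        step (∈⊤ , w∉X) (E-next w) (step (∈⊤ , q∉X) (E-next (next w))
          (edgeʷ (∈⊤ , y∈X⇒one-rim∈X y∈X (≢-sym (next²≢prev 3≤K w)) p∈X) (∈⊤ , h∉X)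
                 (E-r-h (next (next w)) (next²≢id w) (λ e → next≢id (next w) (trans e (sym q≡o))))))
      ...   | no _ | _ | yes p∈X | yes q∈X = ⊥-elim (y∈X⇒one-rim∈X y∈X (prev≢next w) p∈X q∈X)
      ...   | yes p≡o | _ | _ | no q∉X =
        step (∈⊤ , w∉X) (E-next w) (edgeʷ (∈⊤ , q∉X) (∈⊤ , h∉X)
          (E-r-h (next w) (next≢id w) (λ e → prev≢next w (trans p≡o (sym e)))))
      ...   | yes p≡o | _ | _ | yes q∈X =
        step (∈⊤ , w∉X) (E-prev w) (step (∈⊤ , y∈X⇒one-rim∈X y∈X (≢-sym (prev≢next w)) q∈X) (E-prev (prev w))
          (edgeʷ (∈⊤ , y∈X⇒one-rim∈X y∈X (≢-sym (prev²≢next 3≤K w)) q∈X) (∈⊤ , h∉X)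
                 (E-r-h (prev (prev w)) (prev²≢id w) (λ e → prev≢id (prev w) (trans e (sym p≡o))))))

      to-hub : ∀ u → u ∉ₗ X → Walk E Ok u h
      to-hub zero          y∉X = edgeʷ (∈⊤ , y∉X) (∈⊤ , h∉X) E-y-h
      to-hub (suc zero)    _   = here (∈⊤ , h∉X)
      to-hub (suc (suc r)) r∉X with r ≟ t | r ≟ s
      ... | yes refl | _        = from-spokeless t s (trans (es-sym H (rim t) y) (E-y (inj₂ (inj₂ refl))))
                                                 (λ r′ r′≢t r′≢s → E-rim-hub r′ r′≢t r′≢s) r∉X
      ... | no _     | yes refl = from-spokeless s t (trans (es-sym H (rim s) y) (E-y (inj₂ (inj₁ refl))))
                                                 (λ r′ r′≢s r′≢t → E-rim-hub r′ r′≢t r′≢s) r∉X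
      ... | no r≢t   | no r≢s   = edgeʷ (∈⊤ , r∉X) (∈⊤ , h∉X) (E-rim-hub r r≢t r≢s)

    not-superMinimal : ¬ SuperMinimal3Connected B
    not-superMinimal =
      deletable-spoke⇒¬superMinimal (λ (_ , e) → s≢t (sym (suc-injective e))) (λ { (() , _) }) cycle HubKept.to-hub

module RimBridge (m : ℕ) (3≤K : 3 ≤ 2 + m) where
  open WheelRim m

  rim-next-bridge-not-superMinimal : ∀ i x → x ≢ i → x ≢ next i →
                                     ¬ SuperMinimal3Connected (bridge (Wheel m) (suc x) (suc i) (suc (next i)))
  rim-next-bridge-not-superMinimal i x x≢i x≢next-i =
    RimBridgeRimEdge.not-superMinimal m 3≤K (next^ s i) (next^ s x) (rotated-next≡0 i)
      (x≢i ∘ next^-injective s) (λ e → x≢next-i (next^-injective s (trans e (sym (next^-wrap (next i))))))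
    ∘ SuperMinimal3Connected-transport (bridge-rotate-rim-edge i (rotation-rim s x))
    where
    s : ℕ
    s = rotate-to-last i

  rim-bridge-not-superMinimal : ∀ x {a b} → adj (Wheel m) a b ≡ true → suc x ≢ a → suc x ≢ b →
                                ¬ SuperMinimal3Connected (bridge (Wheel m) (suc x) a b)
  rim-bridge-not-superMinimal x {zero}  {suc s} _ _ x≢b =
    RimBridgeSpoke.not-superMinimal m 3≤K s x (λ s≡x → x≢b (cong suc (sym s≡x)))
  rim-bridge-not-superMinimal x {suc s} {zero}  _ x≢a _ =
    RimBridgeSpoke.not-superMinimal m 3≤K s x (λ s≡x → x≢a (cong suc (sym s≡x)))
    ∘ SuperMinimal3Connected-transport (bridge-comm (Wheel m) (suc x) (suc s) zero)
  rim-bridge-not-superMinimal x {suc i} {suc j} ij x≢a x≢b with rim-adj⁻ i j ij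
  ... | inj₁ refl = rim-next-bridge-not-superMinimal i x (x≢a ∘ cong suc) (x≢b ∘ cong suc)
  ... | inj₂ refl = rim-next-bridge-not-superMinimal j x (x≢b ∘ cong suc) (x≢a ∘ cong suc)
                    ∘ SuperMinimal3Connected-transport (bridge-comm (Wheel m) (suc x) (suc (next j)) (suc j))

module _ {G : Graph} {x a b : Fin (n G)} where

  hubAndRimEdge⇒wheel : HubAndRimEdge G x a b → IsWheel (bridge G x a b)
  hubAndRimEdge⇒wheel (m , φ , x↦hub , i , j , a↦i , b↦j , ij) =
    suc m , ≅-trans (bridge-≅ φ x↦hub a↦i b↦j)
                    (HubBridge.bridge-hub-rim≅ m i j
                      (WheelRim.rim-adj⁻ m i j (subst₂ (λ p q → adj (Wheel m) p q ≡ true) a↦i b↦j ij)))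

  hubAndRimEdge⇒superMinimal : HubAndRimEdge G x a b → SuperMinimal3Connected (bridge G x a b)
  hubAndRimEdge⇒superMinimal hre with hubAndRimEdge⇒wheel hre
  ... | m , ψ = SuperMinimal3Connected-transport (≅-sym ψ) (WheelSuperMinimal.wheel-superMinimal m)

  module _ (ab : adj G a b ≡ true) (x≢a : x ≢ a) (x≢b : x ≢ b) where

    hub⇒hubAndRimEdge : ∀ m (φ : G ≅ Wheel m) → Iso.to φ x ≡ hub m → HubAndRimEdge G x a b
    hub⇒hubAndRimEdge m φ x↦hub with Iso.to φ a in a↦ | Iso.to φ b in b↦
    ... | zero  | _     = ⊥-elim (x≢a (Iso.to-injective φ (trans x↦hub (sym a↦))))
    ... | suc _ | zero  = ⊥-elim (x≢b (Iso.to-injective φ (trans x↦hub (sym b↦))))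
    ... | suc i | suc j = m , φ , x↦hub , i , j , a↦ , b↦ , trans (pres φ a b) ab

    superMinimal⇒hubAndRimEdge : IsWheel G → SuperMinimal3Connected (bridge G x a b) → HubAndRimEdge G x a b
    superMinimal⇒hubAndRimEdge (m , φ) sm with Iso.to φ x in x↦
    ... | zero = hub⇒hubAndRimEdge m φ x↦
    superMinimal⇒hubAndRimEdge (zero , φ) sm | suc t with K4-transitive (suc t)
    ... | σ , t↦hub = hub⇒hubAndRimEdge 0 (≅-trans φ σ) (trans (cong (Iso.to σ) x↦) t↦hub)
    superMinimal⇒hubAndRimEdge (suc m , φ) sm | suc t =
      ⊥-elim (RimBridge.rim-bridge-not-superMinimal (suc m) (s≤s (s≤s (s≤s z≤n))) t (trans (pres φ a b) ab)
                (λ e → x≢a (Iso.to-injective φ (trans x↦ e))) (λ e → x≢b (Iso.to-injective φ (trans x↦ e)))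
                (SuperMinimal3Connected-transport (bridge-≅ φ x↦ refl refl) sm))

lemma5p2 : (G : Graph) → IsWheel G →
           (x a b : Fin (Graph.n G)) → adj G a b ≡ true → x ≢ a → x ≢ b →
           (SuperMinimal3Connected (bridge G x a b) ⇔ HubAndRimEdge G x a b) ×
           (SuperMinimal3Connected (bridge G x a b) → IsWheel (bridge G x a b))
lemma5p2 G isWheel x a b ab x≢a x≢b =
  mk⇔ only-if hubAndRimEdge⇒superMinimal , hubAndRimEdge⇒wheel ∘ only-if
  where
  only-if : SuperMinimal3Connected (bridge G x a b) → HubAndRimEdge G x a b
  only-if = superMinimal⇒hubAndRimEdge ab x≢a x≢b isWheel
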